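{- Let $(P_n)_{n\ge 0}$ be the Pell numbers, $P_0=0$, $P_1=1$, $P_n=2P_{n-1}+P_{n-2}$ for $n\ge 2$. For a positive integer $m$, the sequence $(P_n)$ modulo $m$ is residue complete if and only if $m=2$, or $m=3^a$, or $m=5^b$ for some nonnegative integers $a,b$.
   Context: A sequence of integers $(x_n)_{n\ge0}$ is residue complete modulo $m$ if for every residue class $x\in\mathbb{Z}_m$ there is some $n$ with $x_n\equiv x \pmod m$. -}

module Defs where

open import Data.Nat using (ℕ; zero; suc; _+_; _*_; _<_; NonZero)
open import Data.Nat.DivMod using (_%_)
open import Data.Product using (∃)
open import Relation.Binary.PropositionalEquality using (_≡_)

pell : ℕ → ℕ
pell zero = zero
pell (suc zero) = suc zero
pell (suc (suc n)) = 2 * pell (suc n) + pell n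

ResidueComplete : (x : ℕ → ℕ) (m : ℕ) .{{_ : NonZero m}} → Set
ResidueComplete x m = ∀ r → r < m → ∃ λ n → x n % m ≡ r

module Submission where

-- Modulo a prime p ≥ 7 some residue is missed. Since (P (n+1) - P n)² - 2 P n² = ±1, one of
-- 2 P n² ± 1 is a square modulo p; on the other hand, Jacobsthal sums of the quadratic
-- character χ give Σₓ (1 - χ (2x² + 1)) (1 - χ (2x² - 1)) > 0, so some x makes both non-squares.
-- Modulo 4, 6, 10 and 15 a missed residue is read off the period of P.
-- Conversely P is complete modulo 2, 3 and 5, and completeness lifts from qᵃ⁺¹ to qᵃ⁺² for
-- q = 3, 5: if T is a period of P modulo M = qᵃ⁺¹, then P (k T + n) ≡ P n + k M g (mod q M) with
-- g ≡ u₀ P (n+1) + v₀ P n (mod q) a unit along the residues constructed, so k can be chosen to hit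
-- any lift. A modulus with none of 4, 6, 10, 15 or a prime ≥ 7 as a divisor is 2, 3ᵃ or 5ᵇ.

open import Defs
open import Data.Nat using (ℕ; _^_; NonZero)
open import Data.Product using (∃)
open import Data.Sum using (_⊎_)
open import Function.Bundles using (_⇔_)
open import Relation.Binary.PropositionalEquality using (_≡_)

open import Data.Empty using (⊥; ⊥-elim)
open import Data.Fin as Fin using (Fin; toℕ; fromℕ<)
import Data.Fin.Properties as FinP
open import Data.Fin.Permutation using (permutation)
open import Data.Integer as ℤ using (ℤ; +_; _+_; _*_; _-_; -_; 0ℤ; 1ℤ; -1ℤ; _≤_)
open import Data.Integer.DivMod using (_%ℕ_; _/ℕ_; n%ℕd<d; a≡a%ℕn+[a/ℕn]*n)
open import Data.Integer.Divisibility.Signed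
  using (_∣_; divides; quotient; _∣?_; ∣ᵤ⇒∣; ∣⇒∣ᵤ; ∣-trans; ∣m∣n⇒∣m+n; ∣m⇒∣-m; ∣n⇒∣m*n)
import Data.Integer.Properties as ℤP
open import Algebra.Properties.AbelianGroup ℤP.+-0-abelianGroup using () renaming (∙-cancelˡ to +-cancelˡ)
open import Algebra.Properties.Semiring.Sum ℤP.+-*-semiring
  using (sum; sum-syntax; sum-cong-≗; ∑-distrib-+; ∑-comm; sum-permute; sum-remove; *-distribˡ-sum)
open import Data.Integer.Tactic.RingSolver using (solve-∀)
open import Data.List using ([]; _∷_)
open import Data.List.Relation.Unary.All using (All; []; _∷_)
open import Data.Nat as ℕ using (zero; suc; _%_; _/_; s≤s)
import Data.Nat.DivMod as ℕD
import Data.Nat.Divisibility as ℕ∣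
open import Data.Nat.Coprimality using (prime⇒coprime; coprime-Bézout)
open import Data.Nat.GCD using (module Bézout)
open import Data.Nat.ListAction using (product)
open import Data.Nat.Primality
  using (Prime; prime?; prime⇒nonZero; prime⇒nonTrivial; prime⇒¬composite; composite[4]; composite[6]; euclidsLemma)
open import Data.Nat.Primality.Factorisation using (factorise; PrimeFactorisation)
import Data.Nat.Properties as ℕP
open import Data.Product using (_,_; _×_; proj₁; proj₂)
open import Data.Sum using (inj₁; inj₂; [_,_]; reduce) renaming (map to ⊎-map)
open import Data.Vec.Functional using (Vector)
open import Function using (_∘_)
open import Function.Bundles using (mk⇔)
open import Function.Definitions using (Congruent)
open import Relation.Binary.Bundles using (Setoid)
import Relation.Binary.Reasoning.Setoid
open import Relation.Binary.PropositionalEquality using (_≢_; refl; sym; trans; cong; cong₂; subst; subst₂; module ≡-Reasoning)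
open import Relation.Binary.Structures using (IsEquivalence)
open import Relation.Nullary using (Dec; yes; no; ¬_; _×-dec_)
open import Relation.Nullary.Decidable as Dec using (True; False; toWitness; toWitnessFalse; from-yes; ¬?)
open import Relation.Nullary.Negation using (contradiction)

-- Congruences of integers

module Congruence (m : ℤ) where

  infix 4 _≈_
  record _≈_ (a b : ℤ) : Set where
    constructor ≈-intro
    field ∣-difference : m ∣ a - b
  open _≈_ public

  ∣⇒≈0 : ∀ {a} → m ∣ a → a ≈ 0ℤ
  ∣⇒≈0 {a} m∣a = ≈-intro (subst (m ∣_) (sym (ℤP.+-identityʳ a)) m∣a)

  ≈0⇒∣ : ∀ {a} → a ≈ 0ℤ → m ∣ a
  ≈0⇒∣ {a} (≈-intro m∣a) = subst (m ∣_) (ℤP.+-identityʳ a) m∣a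

  m*x≈0 : ∀ x → m * x ≈ 0ℤ
  m*x≈0 x = ∣⇒≈0 (divides x (ℤP.*-comm m x))

  ≈-reflexive : ∀ {a b} → a ≡ b → a ≈ b
  ≈-reflexive {a} refl = ≈-intro (subst (m ∣_) (sym (ℤP.+-inverseʳ a)) (divides 0ℤ refl))

  ≈-refl : ∀ {a} → a ≈ a
  ≈-refl = ≈-reflexive refl

  ≈-sym : ∀ {a b} → a ≈ b → b ≈ a
  ≈-sym {a} {b} (≈-intro m∣a-b) = ≈-intro (subst (m ∣_) (swap a b) (∣m⇒∣-m m∣a-b))
    where
    swap : ∀ a b → - (a - b) ≡ b - a
    swap = solve-∀

  ≈-trans : ∀ {a b c} → a ≈ b → b ≈ c → a ≈ c
  ≈-trans {a} {b} {c} (≈-intro m∣a-b) (≈-intro m∣b-c) =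
    ≈-intro (subst (m ∣_) (telescope a b c) (∣m∣n⇒∣m+n m∣a-b m∣b-c))
    where
    telescope : ∀ a b c → (a - b) + (b - c) ≡ a - c
    telescope = solve-∀

  ≈-isEquivalence : IsEquivalence _≈_
  ≈-isEquivalence = record { refl = ≈-refl ; sym = ≈-sym ; trans = ≈-trans }

  ≈-setoid : Setoid _ _
  ≈-setoid = record { isEquivalence = ≈-isEquivalence }

  module ≈-Reasoning = Relation.Binary.Reasoning.Setoid ≈-setoid

  +-cong : ∀ {a b c d} → a ≈ b → c ≈ d → a + c ≈ b + d
  +-cong {a} {b} {c} {d} (≈-intro m∣a-b) (≈-intro m∣c-d) =
    ≈-intro (subst (m ∣_) (regroup a b c d) (∣m∣n⇒∣m+n m∣a-b m∣c-d))
    where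
    regroup : ∀ a b c d → (a - b) + (c - d) ≡ (a + c) - (b + d)
    regroup = solve-∀

  +-congˡ : ∀ c {a b} → a ≈ b → c + a ≈ c + b
  +-congˡ c = +-cong (≈-refl {c})

  +-congʳ : ∀ c {a b} → a ≈ b → a + c ≈ b + c
  +-congʳ c a≈b = +-cong a≈b (≈-refl {c})

  -‿cong : ∀ {a b} → a ≈ b → - a ≈ - b
  -‿cong {a} {b} (≈-intro m∣a-b) = ≈-intro (subst (m ∣_) (regroup a b) (∣m⇒∣-m m∣a-b))
    where
    regroup : ∀ a b → - (a - b) ≡ - a - - b
    regroup = solve-∀

  *-congˡ : ∀ c {a b} → a ≈ b → c * a ≈ c * b
  *-congˡ c {a} {b} (≈-intro m∣a-b) = ≈-intro (subst (m ∣_) (distrib c a b) (∣n⇒∣m*n c m∣a-b))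
    where
    distrib : ∀ c a b → c * (a - b) ≡ c * a - c * b
    distrib = solve-∀

  *-congʳ : ∀ c {a b} → a ≈ b → a * c ≈ b * c
  *-congʳ c {a} {b} a≈b = subst₂ _≈_ (ℤP.*-comm c a) (ℤP.*-comm c b) (*-congˡ c a≈b)

  *-cong : ∀ {a b c d} → a ≈ b → c ≈ d → a * c ≈ b * d
  *-cong {b = b} {c} a≈b c≈d = ≈-trans (*-congʳ c a≈b) (*-congˡ b c≈d)

  ≈⇒-≈0 : ∀ {a b} → a ≈ b → a - b ≈ 0ℤ
  ≈⇒-≈0 (≈-intro m∣a-b) = ∣⇒≈0 m∣a-b

  -≈0⇒≈ : ∀ {a b} → a - b ≈ 0ℤ → a ≈ b
  -≈0⇒≈ a-b≈0 = ≈-intro (≈0⇒∣ a-b≈0)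

  infix 4 _≈?_
  _≈?_ : ∀ a b → Dec (a ≈ b)
  a ≈? b = Dec.map′ ≈-intro ∣-difference (m ∣? (a - b))

infix 4 _≡_mod_
_≡_mod_ : ℤ → ℤ → ℤ → Set
_≡_mod_ a b m = Congruence._≈_ m a b

≡-mod-weaken : ∀ {m n a b} → m ∣ n → a ≡ b mod n → a ≡ b mod m
≡-mod-weaken m∣n (Congruence.≈-intro n∣a-b) = Congruence.≈-intro (∣-trans m∣n n∣a-b)

≡-mod-scale : ∀ c {m a b} → a ≡ b mod m → c * a ≡ c * b mod c * m
≡-mod-scale c {m} {a} {b} (Congruence.≈-intro (divides k a-b≡km)) = Congruence.≈-intro (divides k (begin
  c * a - c * b     ≡⟨ distrib c a b ⟩
  c * (a - b)       ≡⟨ cong (c *_) a-b≡km ⟩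
  c * (k * m)       ≡⟨ swap c k m ⟩
  k * (c * m)       ∎))
  where
  open ≡-Reasoning
  distrib : ∀ c a b → c * a - c * b ≡ c * (a - b)
  distrib = solve-∀
  swap : ∀ c k m → c * (k * m) ≡ k * (c * m)
  swap = solve-∀

≡-mod⇒∃ : ∀ {m a b} → a ≡ b mod m → ∃ λ k → a ≡ b + k * m
≡-mod⇒∃ {m} {a} {b} (Congruence.≈-intro (divides k a-b≡km)) = k , trans (split a b) (cong (_+_ b) a-b≡km)
  where
  split : ∀ a b → a ≡ b + (a - b)
  split = solve-∀

module Residues (M : ℕ) .{{_ : NonZero M}} where

  open Congruence (+ M)

  ≈-%ℕ : ∀ a → a ≈ + (a %ℕ M)
  ≈-%ℕ a = ≈-intro (divides (a /ℕ M) (begin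
    a - + (a %ℕ M)                           ≡⟨ cong (_- + (a %ℕ M)) (a≡a%ℕn+[a/ℕn]*n a M) ⟩
    + (a %ℕ M) + (a /ℕ M) * + M - + (a %ℕ M) ≡⟨ cancel (+ (a %ℕ M)) ((a /ℕ M) * + M) ⟩
    (a /ℕ M) * + M                           ∎))
    where
    open ≡-Reasoning
    cancel : ∀ r x → r + x - r ≡ x
    cancel = solve-∀

  private
    distance-∣ : ∀ {r s} → r ℕ.≤ s → + r ≈ + s → M ℕ∣.∣ s ℕ.∸ r
    distance-∣ {r} {s} r≤s r≈s =
      subst (M ℕ∣.∣_) (trans (cong ℤ.∣_∣ (ℤP.m-n≡m⊖n r s)) (ℤP.∣⊖∣-≤ r≤s)) (∣⇒∣ᵤ (∣-difference r≈s))

    ordered-unique : ∀ {r s} → r ℕ.≤ s → s ℕ.< M → + r ≈ + s → r ≡ s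
    ordered-unique {r} {s} r≤s s<M r≈s with ℕP.m≤n⇒m<n∨m≡n r≤s
    ... | inj₂ r≡s = r≡s
    ... | inj₁ r<s = contradiction (distance-∣ r≤s r≈s)
                       (ℕ∣.>⇒∤ {{ℕ.>-nonZero (ℕP.m<n⇒0<n∸m r<s)}} (ℕP.≤-<-trans (ℕP.m∸n≤m s r) s<M))

  ≈⇒≡-below : ∀ {r s} → r ℕ.< M → s ℕ.< M → + r ≈ + s → r ≡ s
  ≈⇒≡-below {r} {s} r<M s<M r≈s with ℕP.≤-total r s
  ... | inj₁ r≤s = ordered-unique r≤s s<M r≈s
  ... | inj₂ s≤r = sym (ordered-unique s≤r r<M (≈-sym r≈s))

  ≈⇒%ℕ≡ : ∀ {a b} → a ≈ b → a %ℕ M ≡ b %ℕ M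
  ≈⇒%ℕ≡ {a} {b} a≈b = ≈⇒≡-below (n%ℕd<d a M) (n%ℕd<d b M)
    (≈-trans (≈-sym (≈-%ℕ a)) (≈-trans a≈b (≈-%ℕ b)))

  %ℕ≡⇒≈ : ∀ {a b} → a %ℕ M ≡ b %ℕ M → a ≈ b
  %ℕ≡⇒≈ {a} {b} eq = ≈-trans (≈-%ℕ a) (≈-trans (≈-reflexive (cong +_ eq)) (≈-sym (≈-%ℕ b)))

-- The field ℤ/p and sums over it

sum-const : ∀ n c → ∑[ i < n ] c ≡ + n * c
sum-const zero c = sym (ℤP.*-zeroˡ c)
sum-const (suc n) c = trans (cong (_+_ c) (sum-const n c)) (sym (ℤP.suc-* (+ n) c))

sum-mono-≤ : ∀ {n} {t u : Vector ℤ n} → (∀ i → t i ≤ u i) → sum t ≤ sum u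
sum-mono-≤ {zero} t≤u = ℤP.≤-refl
sum-mono-≤ {suc n} t≤u = ℤP.+-mono-≤ (t≤u Fin.zero) (sum-mono-≤ (λ i → t≤u (Fin.suc i)))

sum-supported : ∀ {n} (t : Vector ℤ n) i → (∀ j → j ≢ i → t j ≡ 0ℤ) → sum t ≡ t i
sum-supported {suc n} t i vanish = begin
  sum t                                  ≡⟨ sum-remove t ⟩
  t i + ∑[ j < n ] t (Fin.punchIn i j)   ≡⟨ cong (_+_ (t i)) (sum-cong-≗ (λ j → vanish _ (FinP.punchInᵢ≢i i j))) ⟩
  t i + ∑[ j < n ] 0ℤ                    ≡⟨ cong (_+_ (t i)) (trans (sum-const n 0ℤ) (ℤP.*-zeroʳ (+ n))) ⟩
  t i + 0ℤ                               ≡⟨ ℤP.+-identityʳ (t i) ⟩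
  t i                                    ∎
  where open ≡-Reasoning

module PrimeField (p : ℕ) (p-prime : Prime p) where

  instance
    p≢0 : NonZero p
    p≢0 = prime⇒nonZero p-prime

  open Congruence (+ p) public
  open Residues p public

  small≉0 : ∀ {k} → 0 ℕ.< k → k ℕ.< p → ¬ + k ≈ 0ℤ
  small≉0 {suc k} 0<k k<p k≈0 with ≈⇒≡-below k<p (ℕP.<-trans 0<k k<p) k≈0
  ... | ()

  prime-∣-* : ∀ {a b} → + p ∣ a * b → + p ∣ a ⊎ + p ∣ b
  prime-∣-* {a} {b} p∣ab with euclidsLemma ℤ.∣ a ∣ ℤ.∣ b ∣ p-prime
                                 (subst (p ℕ∣.∣_) (ℤP.abs-* a b) (∣⇒∣ᵤ p∣ab))
  ... | inj₁ p∣a = inj₁ (∣ᵤ⇒∣ p∣a)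
  ... | inj₂ p∣b = inj₂ (∣ᵤ⇒∣ p∣b)

  *≈0⇒≈0∨≈0 : ∀ {a b} → a * b ≈ 0ℤ → a ≈ 0ℤ ⊎ b ≈ 0ℤ
  *≈0⇒≈0∨≈0 ab≈0 with prime-∣-* (≈0⇒∣ ab≈0)
  ... | inj₁ p∣a = inj₁ (∣⇒≈0 p∣a)
  ... | inj₂ p∣b = inj₂ (∣⇒≈0 p∣b)

  *-≉0 : ∀ {a b} → ¬ a ≈ 0ℤ → ¬ b ≈ 0ℤ → ¬ a * b ≈ 0ℤ
  *-≉0 a≉0 b≉0 ab≈0 = [ a≉0 , b≉0 ] (*≈0⇒≈0∨≈0 ab≈0)

  *-zeroˡ-≈ : ∀ {a} b → a ≈ 0ℤ → a * b ≈ 0ℤ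
  *-zeroˡ-≈ b a≈0 = ≈-trans (*-congʳ b a≈0) (≈-reflexive (ℤP.*-zeroˡ b))

  *-zeroʳ-≈ : ∀ a {b} → b ≈ 0ℤ → a * b ≈ 0ℤ
  *-zeroʳ-≈ a b≈0 = ≈-trans (*-congˡ a b≈0) (≈-reflexive (ℤP.*-zeroʳ a))

  private
    residue-inverse : ∀ r → .{{NonZero r}} → r ℕ.< p → ∃ λ b → + r * b ≈ 1ℤ
    residue-inverse r r<p with coprime-Bézout (prime⇒coprime p-prime r<p)
    ... | Bézout.+- x y eq = - + y , ≈-intro (divides (- + x) (begin
      + r * - + y - 1ℤ          ≡⟨ negate (+ r) (+ y) ⟩
      - (1ℤ + + y * + r)        ≡⟨ cong -_ (lift-+- x y eq) ⟩
      - (+ x * + p)             ≡⟨ ℤP.neg-distribˡ-* (+ x) (+ p) ⟩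
      - + x * + p               ∎))
      where
      open ≡-Reasoning
      negate : ∀ r y → r * - y - 1ℤ ≡ - (1ℤ + y * r)
      negate = solve-∀
      lift-+- : ∀ x y → 1 ℕ.+ y ℕ.* r ≡ x ℕ.* p → 1ℤ + + y * + r ≡ + x * + p
      lift-+- x y eq = trans (cong (_+_ 1ℤ) (sym (ℤP.pos-* y r)))
                         (trans (sym (ℤP.pos-+ 1 (y ℕ.* r))) (trans (cong +_ eq) (ℤP.pos-* x p)))
    ... | Bézout.-+ x y eq = + y , ≈-intro (divides (+ x) (begin
      + r * + y - 1ℤ            ≡⟨ cong (_- 1ℤ) (trans (ℤP.*-comm (+ r) (+ y)) (sym (ℤP.pos-* y r))) ⟩
      + (y ℕ.* r) - 1ℤ          ≡⟨ cong (λ z → + z - 1ℤ) (sym eq) ⟩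
      + (1 ℕ.+ x ℕ.* p) - 1ℤ    ≡⟨ cong (_- 1ℤ) (trans (ℤP.pos-+ 1 (x ℕ.* p)) (cong (_+_ 1ℤ) (ℤP.pos-* x p))) ⟩
      1ℤ + + x * + p - 1ℤ       ≡⟨ cancel (+ x * + p) ⟩
      + x * + p                 ∎))
      where
      open ≡-Reasoning
      cancel : ∀ z → 1ℤ + z - 1ℤ ≡ z
      cancel = solve-∀

  inverse-exists : ∀ {a} → ¬ a ≈ 0ℤ → ∃ λ b → a * b ≈ 1ℤ
  inverse-exists {a} a≉0 with a %ℕ p in eq
  ... | zero = contradiction (≈-trans (≈-%ℕ a) (≈-reflexive (cong +_ eq))) a≉0
  ... | suc r with residue-inverse (suc r) (subst (ℕ._< p) eq (n%ℕd<d a p))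
  ...   | b , rb≈1 = b , ≈-trans (*-congʳ b (≈-trans (≈-%ℕ a) (≈-reflexive (cong +_ eq)))) rb≈1

  opaque
    -- Junk value: the inverse of 0 is 0.
    inverse : ℤ → ℤ
    inverse a with a ≈? 0ℤ
    ... | yes _ = 0ℤ
    ... | no a≉0 = proj₁ (inverse-exists a≉0)

    *-inverseʳ : ∀ {a} → ¬ a ≈ 0ℤ → a * inverse a ≈ 1ℤ
    *-inverseʳ {a} a≉0 with a ≈? 0ℤ
    ... | yes a≈0 = contradiction a≈0 a≉0
    ... | no a≉0′ = proj₂ (inverse-exists a≉0′)

    inverse-zero : ∀ {a} → a ≈ 0ℤ → inverse a ≡ 0ℤ
    inverse-zero {a} a≈0 with a ≈? 0ℤ
    ... | yes _ = refl
    ... | no a≉0 = contradiction a≈0 a≉0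

  *-inverseˡ : ∀ {a} → ¬ a ≈ 0ℤ → inverse a * a ≈ 1ℤ
  *-inverseˡ {a} a≉0 = ≈-trans (≈-reflexive (ℤP.*-comm (inverse a) a)) (*-inverseʳ a≉0)

  1≉0 : ¬ 1ℤ ≈ 0ℤ
  1≉0 = small≉0 ℕP.0<1+n (ℕ.nonTrivial⇒n>1 p {{prime⇒nonTrivial p-prime}})

  inverse-≉0 : ∀ {a} → ¬ a ≈ 0ℤ → ¬ inverse a ≈ 0ℤ
  inverse-≉0 {a} a≉0 a⁻¹≈0 = 1≉0 (≈-trans (≈-sym (*-inverseʳ a≉0)) (*-zeroʳ-≈ a a⁻¹≈0))

  *-cancelˡ-inverse : ∀ {a} → ¬ a ≈ 0ℤ → ∀ b → inverse a * (a * b) ≈ b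
  *-cancelˡ-inverse {a} a≉0 b = begin
    inverse a * (a * b)   ≡⟨ ℤP.*-assoc (inverse a) a b ⟨
    inverse a * a * b     ≈⟨ *-congʳ b (*-inverseˡ a≉0) ⟩
    1ℤ * b                ≡⟨ ℤP.*-identityˡ b ⟩
    b                     ∎
    where open ≈-Reasoning

  *-cancelʳ-inverse : ∀ {a} → ¬ a ≈ 0ℤ → ∀ b → a * (inverse a * b) ≈ b
  *-cancelʳ-inverse {a} a≉0 b = begin
    a * (inverse a * b)   ≡⟨ ℤP.*-assoc a (inverse a) b ⟨
    a * inverse a * b     ≈⟨ *-congʳ b (*-inverseʳ a≉0) ⟩
    1ℤ * b                ≡⟨ ℤP.*-identityˡ b ⟩
    b                     ∎
    where open ≈-Reasoning

  inverse-cong : Congruent _≈_ _≈_ inverse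
  inverse-cong {a} {b} a≈b = by-cases (a ≈? 0ℤ)
    where
    open ≈-Reasoning
    by-cases : Dec (a ≈ 0ℤ) → inverse a ≈ inverse b
    by-cases (yes a≈0) = ≈-reflexive (trans (inverse-zero a≈0) (sym (inverse-zero (≈-trans (≈-sym a≈b) a≈0))))
    by-cases (no a≉0) = begin
      inverse a                       ≈⟨ ≈-sym (*-cancelˡ-inverse b≉0 (inverse a)) ⟩
      inverse b * (b * inverse a)     ≈⟨ *-congˡ (inverse b) (*-congʳ (inverse a) (≈-sym a≈b)) ⟩
      inverse b * (a * inverse a)     ≈⟨ *-congˡ (inverse b) (*-inverseʳ a≉0) ⟩
      inverse b * 1ℤ                  ≡⟨ ℤP.*-identityʳ (inverse b) ⟩
      inverse b                       ∎
      where
      b≉0 : ¬ b ≈ 0ℤ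
      b≉0 b≈0 = a≉0 (≈-trans a≈b b≈0)

  element : Fin p → ℤ
  element i = + toℕ i

  toFin : ℤ → Fin p
  toFin a = fromℕ< (n%ℕd<d a p)

  element-toFin : ∀ a → element (toFin a) ≈ a
  element-toFin a = ≈-trans (≈-reflexive (cong +_ (FinP.toℕ-fromℕ< (n%ℕd<d a p)))) (≈-sym (≈-%ℕ a))

  element-injective : ∀ {i j} → element i ≈ element j → i ≡ j
  element-injective {i} {j} i≈j = FinP.toℕ-injective (≈⇒≡-below (FinP.toℕ<n i) (FinP.toℕ<n j) i≈j)

  Σ : (ℤ → ℤ) → ℤ
  Σ f = ∑[ i < p ] f (element i)

  Σ-cong : ∀ {f g} → (∀ x → f x ≡ g x) → Σ f ≡ Σ g
  Σ-cong f≗g = sum-cong-≗ (λ i → f≗g (element i))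

  Σ-+ : ∀ f g → Σ (λ x → f x + g x) ≡ Σ f + Σ g
  Σ-+ f g = ∑-distrib-+ (λ i → f (element i)) (λ i → g (element i))

  Σ-*ˡ : ∀ c f → Σ (λ x → c * f x) ≡ c * Σ f
  Σ-*ˡ c f = sym (*-distribˡ-sum c (λ i → f (element i)))

  Σ-*ʳ : ∀ c f → Σ (λ x → f x * c) ≡ Σ f * c
  Σ-*ʳ c f = trans (Σ-cong (λ x → ℤP.*-comm (f x) c)) (trans (Σ-*ˡ c f) (ℤP.*-comm c (Σ f)))

  Σ-neg : ∀ f → Σ (λ x → - f x) ≡ - Σ f
  Σ-neg f = trans (Σ-cong (λ x → sym (ℤP.-1*i≡-i (f x)))) (trans (Σ-*ˡ -1ℤ f) (ℤP.-1*i≡-i (Σ f)))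

  Σ-- : ∀ f g → Σ (λ x → f x - g x) ≡ Σ f - Σ g
  Σ-- f g = trans (Σ-+ f (λ x → - g x)) (cong (_+_ (Σ f)) (Σ-neg g))

  Σ-const : ∀ c → Σ (λ _ → c) ≡ + p * c
  Σ-const = sum-const p

  Σ-zero : Σ (λ _ → 0ℤ) ≡ 0ℤ
  Σ-zero = trans (Σ-const 0ℤ) (ℤP.*-zeroʳ (+ p))

  Σ-comm : ∀ (F : ℤ → ℤ → ℤ) → Σ (λ x → Σ (λ y → F x y)) ≡ Σ (λ y → Σ (λ x → F x y))
  Σ-comm F = ∑-comm (λ i j → F (element i) (element j))

  Σ-mono-≤ : ∀ {f g} → (∀ x → f x ≤ g x) → Σ f ≤ Σ g
  Σ-mono-≤ f≤g = sum-mono-≤ (λ i → f≤g (element i))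

  Σ-supported : ∀ {f} c → Congruent _≈_ _≡_ f → (∀ x → ¬ x ≈ c → f x ≡ 0ℤ) → Σ f ≡ f c
  Σ-supported {f} c f-cong vanish =
    trans (sum-supported (λ i → f (element i)) (toFin c) (λ j j≢c → vanish (element j) (outside j j≢c)))
          (f-cong (element-toFin c))
    where
    outside : ∀ j → j ≢ toFin c → ¬ element j ≈ c
    outside j j≢c j≈c = j≢c (element-injective (≈-trans j≈c (≈-sym (element-toFin c))))

  Σ-reindex : ∀ {F} g h → Congruent _≈_ _≡_ F → Congruent _≈_ _≈_ g → Congruent _≈_ _≈_ h →
              (∀ x → g (h x) ≈ x) → (∀ x → h (g x) ≈ x) → Σ (λ x → F (g x)) ≡ Σ F
  Σ-reindex {F} g h F-cong g-cong h-cong gh hg =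
    trans (Σ-cong (λ x → F-cong (≈-sym (element-toFin (g x)))))
          (sym (sum-permute (λ i → F (element i)) (permutation g′ h′ g′h′ h′g′)))
    where
    g′ h′ : Fin p → Fin p
    g′ i = toFin (g (element i))
    h′ i = toFin (h (element i))
    g′h′ : ∀ i → g′ (h′ i) ≡ i
    g′h′ i = element-injective (≈-trans (element-toFin _)
               (≈-trans (g-cong (element-toFin (h (element i)))) (gh (element i))))
    h′g′ : ∀ i → h′ (g′ i) ≡ i
    h′g′ i = element-injective (≈-trans (element-toFin _)
               (≈-trans (h-cong (element-toFin (g (element i)))) (hg (element i))))

  Σ-shift : ∀ {F} c → Congruent _≈_ _≡_ F → Σ (λ x → F (x + c)) ≡ Σ F
  Σ-shift c F-cong = Σ-reindex (λ x → x + c) (λ x → x - c) F-cong (+-congʳ c) (+-congʳ (- c))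
    (λ x → ≈-reflexive (cancel₁ x c)) (λ x → ≈-reflexive (cancel₂ x c))
    where
    cancel₁ : ∀ x c → x - c + c ≡ x
    cancel₁ = solve-∀
    cancel₂ : ∀ x c → x + c - c ≡ x
    cancel₂ = solve-∀

  Σ-scale : ∀ {F c} → ¬ c ≈ 0ℤ → Congruent _≈_ _≡_ F → Σ (λ x → F (c * x)) ≡ Σ F
  Σ-scale {c = c} c≉0 F-cong = Σ-reindex (c *_) (inverse c *_) F-cong (*-congˡ c) (*-congˡ (inverse c))
    (*-cancelʳ-inverse c≉0) (*-cancelˡ-inverse c≉0)

  opaque
    δ : ℤ → ℤ → ℤ
    δ c x with x ≈? c
    ... | yes _ = 1ℤ
    ... | no _ = 0ℤ

    δ-≈ : ∀ {c x} → x ≈ c → δ c x ≡ 1ℤ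
    δ-≈ {c} {x} x≈c with x ≈? c
    ... | yes _ = refl
    ... | no x≉c = contradiction x≈c x≉c

    δ-≉ : ∀ {c x} → ¬ x ≈ c → δ c x ≡ 0ℤ
    δ-≉ {c} {x} x≉c with x ≈? c
    ... | yes x≈c = contradiction x≈c x≉c
    ... | no _ = refl

  δ-cong : ∀ c → Congruent _≈_ _≡_ (δ c)
  δ-cong c {x} {y} x≈y with y ≈? c
  ... | yes y≈c = trans (δ-≈ (≈-trans x≈y y≈c)) (sym (δ-≈ y≈c))
  ... | no y≉c = trans (δ-≉ (λ x≈c → y≉c (≈-trans (≈-sym x≈y) x≈c))) (sym (δ-≉ y≉c))

  Σ-δ* : ∀ c {g} → Congruent _≈_ _≡_ g → Σ (λ x → δ c x * g x) ≡ g c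
  Σ-δ* c {g} g-cong =
    trans (Σ-supported c (λ x≈y → cong₂ _*_ (δ-cong c x≈y) (g-cong x≈y)) vanish)
          (trans (cong (_* g c) (δ-≈ ≈-refl)) (ℤP.*-identityˡ (g c)))
    where
    vanish : ∀ x → ¬ x ≈ c → δ c x * g x ≡ 0ℤ
    vanish x x≉c = trans (cong (_* g x) (δ-≉ x≉c)) (ℤP.*-zeroˡ (g x))

  Σ-δ : ∀ c → Σ (δ c) ≡ 1ℤ
  Σ-δ c = trans (Σ-cong (λ x → sym (ℤP.*-identityʳ (δ c x)))) (Σ-δ* c (λ _ → refl))

  Σ-nonneg : ∀ {f} → (∀ x → 0ℤ ≤ f x) → 0ℤ ≤ Σ f
  Σ-nonneg {f} f≥0 = subst (_≤ Σ f) Σ-zero (Σ-mono-≤ f≥0)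

  puncture : ℤ → (ℤ → ℤ) → ℤ → ℤ
  puncture c f x = (1ℤ - δ c x) * f x

  puncture-cong : ∀ c {f} → Congruent _≈_ _≡_ f → Congruent _≈_ _≡_ (puncture c f)
  puncture-cong c f-cong x≈y = cong₂ (λ d v → (1ℤ - d) * v) (δ-cong c x≈y) (f-cong x≈y)

  puncture-≉ : ∀ {c} f {x} → ¬ x ≈ c → puncture c f x ≡ f x
  puncture-≉ f {x} x≉c = trans (cong (λ d → (1ℤ - d) * f x) (δ-≉ x≉c)) (ℤP.*-identityˡ (f x))

  puncture-nonneg : ∀ c {f} → (∀ x → 0ℤ ≤ f x) → ∀ x → 0ℤ ≤ puncture c f x
  puncture-nonneg c {f} f≥0 x = by-cases (x ≈? c)
    where
    by-cases : Dec (x ≈ c) → 0ℤ ≤ puncture c f x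
    by-cases (yes x≈c) = ℤP.≤-reflexive (sym (trans (cong (λ d → (1ℤ - d) * f x) (δ-≈ x≈c)) (ℤP.*-zeroˡ (f x))))
    by-cases (no x≉c) = subst (0ℤ ≤_) (sym (puncture-≉ f x≉c)) (f≥0 x)

  Σ-puncture : ∀ c {f} → Congruent _≈_ _≡_ f → Σ f ≡ f c + Σ (puncture c f)
  Σ-puncture c {f} f-cong = begin
    Σ f                                        ≡⟨ Σ-cong (λ x → split (δ c x) (f x)) ⟩
    Σ (λ x → δ c x * f x + puncture c f x)    ≡⟨ Σ-+ (λ x → δ c x * f x) (puncture c f) ⟩
    Σ (λ x → δ c x * f x) + Σ (puncture c f)  ≡⟨ cong (_+ Σ (puncture c f)) (Σ-δ* c f-cong) ⟩
    f c + Σ (puncture c f)                     ∎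
    where
    open ≡-Reasoning
    split : ∀ d v → v ≡ d * v + (1ℤ - d) * v
    split = solve-∀

  Σ-≥-three : ∀ {f} → Congruent _≈_ _≡_ f → (∀ x → 0ℤ ≤ f x) →
              ∀ {a b c} → ¬ a ≈ b → ¬ a ≈ c → ¬ b ≈ c → f a + f b + f c ≤ Σ f
  Σ-≥-three {f} f-cong f≥0 {a} {b} {c} a≉b a≉c b≉c = begin
    f a + f b + f c                           ≡⟨ cong₂ (λ u v → f a + u + v) (sym f₁b) (sym (trans f₂c f₁c)) ⟩
    f a + f₁ b + f₂ c                         ≡⟨ solve₃ (f a) (f₁ b) (f₂ c) ⟩
    f a + (f₁ b + (f₂ c + 0ℤ))                ≤⟨ ℤP.+-monoʳ-≤ (f a) (ℤP.+-monoʳ-≤ (f₁ b) (ℤP.+-monoʳ-≤ (f₂ c)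
                                                  (Σ-nonneg (puncture-nonneg c (puncture-nonneg b (puncture-nonneg a f≥0)))))) ⟩
    f a + (f₁ b + (f₂ c + Σ (puncture c f₂)))  ≡⟨ sym (trans (Σ-puncture a f-cong) (cong (_+_ (f a))
                                                   (trans (Σ-puncture b f₁-cong) (cong (_+_ (f₁ b)) (Σ-puncture c f₂-cong))))) ⟩
    Σ f                                       ∎
    where
    open ℤP.≤-Reasoning
    f₁ f₂ : ℤ → ℤ
    f₁ = puncture a f
    f₂ = puncture b f₁
    f₁-cong = puncture-cong a f-cong
    f₂-cong = puncture-cong b f₁-cong
    f₁b : f₁ b ≡ f b
    f₁b = puncture-≉ f (λ b≈a → a≉b (≈-sym b≈a))
    f₁c : f₁ c ≡ f c
    f₁c = puncture-≉ f (λ c≈a → a≉c (≈-sym c≈a))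
    f₂c : f₂ c ≡ f₁ c
    f₂c = puncture-≉ f₁ (λ c≈b → b≉c (≈-sym c≈b))
    solve₃ : ∀ u v w → u + v + w ≡ u + (v + (w + 0ℤ))
    solve₃ = solve-∀

  linear-solution : ∀ {g} → ¬ g ≈ 0ℤ → ∀ c → ∃ λ k → + k * g ≈ c
  linear-solution {g} g≉0 c = (c * inverse g) %ℕ p , (begin
    + ((c * inverse g) %ℕ p) * g   ≈⟨ *-congʳ g (≈-sym (≈-%ℕ (c * inverse g))) ⟩
    c * inverse g * g              ≡⟨ ℤP.*-assoc c (inverse g) g ⟩
    c * (inverse g * g)            ≈⟨ *-congˡ c (*-inverseˡ g≉0) ⟩
    c * 1ℤ                         ≡⟨ ℤP.*-identityʳ c ⟩
    c                              ∎)
    where open ≈-Reasoning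

-- The quadratic character

module QuadraticCharacter (p : ℕ) (p-prime : Prime p) (2<p : 2 ℕ.< p) where

  open PrimeField p p-prime public

  2≉0 : ¬ + 2 ≈ 0ℤ
  2≉0 = small≉0 ℕP.0<1+n 2<p

  IsSquare : ℤ → Set
  IsSquare a = ∃ λ u → u * u ≈ a

  IsSquare-cong : ∀ {a b} → a ≈ b → IsSquare a → IsSquare b
  IsSquare-cong a≈b (u , u²≈a) = u , ≈-trans u²≈a a≈b

  isSquare? : ∀ a → Dec (IsSquare a)
  isSquare? a = Dec.map′ from-Fin to-Fin (FinP.any? (λ i → element i * element i ≈? a))
    where
    from-Fin : (∃ λ i → element i * element i ≈ a) → IsSquare a
    from-Fin (i , i²≈a) = element i , i²≈a
    to-Fin : IsSquare a → ∃ λ i → element i * element i ≈ a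
    to-Fin (u , u²≈a) = toFin u , ≈-trans (*-cong (element-toFin u) (element-toFin u)) u²≈a

  data χ-View (a : ℤ) : ℤ → Set where
    zero      : a ≈ 0ℤ → χ-View a 0ℤ
    square    : ¬ a ≈ 0ℤ → IsSquare a → χ-View a 1ℤ
    nonsquare : ¬ a ≈ 0ℤ → ¬ IsSquare a → χ-View a -1ℤ

  opaque
    χ : ℤ → ℤ
    χ a with a ≈? 0ℤ | isSquare? a
    ... | yes _ | _ = 0ℤ
    ... | no _ | yes _ = 1ℤ
    ... | no _ | no _ = -1ℤ

    χ-view : ∀ a → χ-View a (χ a)
    χ-view a with a ≈? 0ℤ | isSquare? a
    ... | yes a≈0 | _ = zero a≈0
    ... | no a≉0 | yes sq = square a≉0 sq
    ... | no a≉0 | no nsq = nonsquare a≉0 nsq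

  χ-zero : ∀ {a} → a ≈ 0ℤ → χ a ≡ 0ℤ
  χ-zero {a} a≈0 with χ a | χ-view a
  ... | _ | zero _ = refl
  ... | _ | square a≉0 _ = contradiction a≈0 a≉0
  ... | _ | nonsquare a≉0 _ = contradiction a≈0 a≉0

  χ-square : ∀ {a} → ¬ a ≈ 0ℤ → IsSquare a → χ a ≡ 1ℤ
  χ-square {a} a≉0 sq with χ a | χ-view a
  ... | _ | zero a≈0 = contradiction a≈0 a≉0
  ... | _ | square _ _ = refl
  ... | _ | nonsquare _ nsq = contradiction sq nsq

  χ-nonsquare : ∀ {a} → ¬ a ≈ 0ℤ → ¬ IsSquare a → χ a ≡ -1ℤ
  χ-nonsquare {a} a≉0 nsq with χ a | χ-view a
  ... | _ | zero a≈0 = contradiction a≈0 a≉0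
  ... | _ | square _ sq = contradiction sq nsq
  ... | _ | nonsquare _ _ = refl

  χ≡0⇒≈0 : ∀ {a} → χ a ≡ 0ℤ → a ≈ 0ℤ
  χ≡0⇒≈0 {a} χa≡0 with χ a | χ-view a
  ... | _ | zero a≈0 = a≈0
  χ≡0⇒≈0 () | _ | square _ _
  χ≡0⇒≈0 () | _ | nonsquare _ _

  χ-square⇒≢-1 : ∀ {a} → IsSquare a → χ a ≢ -1ℤ
  χ-square⇒≢-1 {a} sq with χ a | χ-view a
  ... | _ | zero _ = λ ()
  ... | _ | square _ _ = λ ()
  ... | _ | nonsquare _ nsq = contradiction sq nsq

  χ-values : ∀ a → χ a ≡ 0ℤ ⊎ χ a ≡ 1ℤ ⊎ χ a ≡ -1ℤ
  χ-values a with χ a | χ-view a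
  ... | _ | zero _ = inj₁ refl
  ... | _ | square _ _ = inj₂ (inj₁ refl)
  ... | _ | nonsquare _ _ = inj₂ (inj₂ refl)

  χ-cong : Congruent _≈_ _≡_ χ
  χ-cong {a} {b} a≈b with χ a | χ-view a
  ... | _ | zero a≈0 = sym (χ-zero (≈-trans (≈-sym a≈b) a≈0))
  ... | _ | square a≉0 sq = sym (χ-square (λ b≈0 → a≉0 (≈-trans a≈b b≈0)) (IsSquare-cong a≈b sq))
  ... | _ | nonsquare a≉0 nsq =
    sym (χ-nonsquare (λ b≈0 → a≉0 (≈-trans a≈b b≈0)) (λ sq → nsq (IsSquare-cong (≈-sym a≈b) sq)))

  χ≤1 : ∀ a → χ a ≤ 1ℤ
  χ≤1 a with χ a | χ-view a
  ... | _ | zero _ = ℤ.+≤+ ℕ.z≤n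
  ... | _ | square _ _ = ℤP.≤-refl
  ... | _ | nonsquare _ _ = ℤ.-≤+

  -1≤χ : ∀ a → -1ℤ ≤ χ a
  -1≤χ a with χ a | χ-view a
  ... | _ | zero _ = ℤ.-≤+
  ... | _ | square _ _ = ℤ.-≤+
  ... | _ | nonsquare _ _ = ℤP.≤-refl

  χ-u² : ∀ {u} → ¬ u ≈ 0ℤ → χ (u * u) ≡ 1ℤ
  χ-u² {u} u≉0 = χ-square (*-≉0 u≉0 u≉0) (u , ≈-refl)

  χ-1 : χ 1ℤ ≡ 1ℤ
  χ-1 = χ-u² 1≉0

  δ-iff : ∀ {c x d y} → (x ≈ c → y ≈ d) → (y ≈ d → x ≈ c) → δ c x ≡ δ d y
  δ-iff {c} {x} {d} {y} to from with x ≈? c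
  ... | yes x≈c = trans (δ-≈ x≈c) (sym (δ-≈ (to x≈c)))
  ... | no x≉c = trans (δ-≉ x≉c) (sym (δ-≉ (λ y≈d → x≉c (from y≈d))))

  δ-sym : ∀ c x → δ c x ≡ δ x c
  δ-sym c x = δ-iff ≈-sym ≈-sym

  u≉-u : ∀ {u} → ¬ u ≈ 0ℤ → ¬ u ≈ - u
  u≉-u {u} u≉0 u≈-u = *-≉0 2≉0 u≉0 (≈-trans (≈-reflexive (double u)) (≈⇒-≈0 u≈-u))
    where
    double : ∀ u → + 2 * u ≡ u - - u
    double = solve-∀

  square-roots : ∀ {u x} → x * x ≈ u * u → x ≈ u ⊎ x ≈ - u
  square-roots {u} {x} x²≈u² = ⊎-map -≈0⇒≈ (λ x+u≈0 → -≈0⇒≈ (≈-trans (≈-reflexive (minus-minus x u)) x+u≈0))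
    (*≈0⇒≈0∨≈0 (≈-trans (≈-reflexive (difference-of-squares x u)) (≈⇒-≈0 x²≈u²)))
    where
    difference-of-squares : ∀ x u → (x - u) * (x + u) ≡ x * x - u * u
    difference-of-squares = solve-∀
    minus-minus : ∀ x u → x - - u ≡ x + u
    minus-minus = solve-∀

  number-of-square-roots : ∀ t → Σ (λ x → δ t (x * x)) ≡ 1ℤ + χ t
  number-of-square-roots t with χ t | χ-view t
  ... | _ | zero t≈0 = trans (Σ-cong (λ x → δ-iff (x²≈t⇒x≈0 x) (λ x≈0 → ≈-trans (*-zeroˡ-≈ x x≈0) (≈-sym t≈0))))
                             (Σ-δ 0ℤ)
    where
    x²≈t⇒x≈0 : ∀ x → x * x ≈ t → x ≈ 0ℤ
    x²≈t⇒x≈0 x x²≈t = reduce (*≈0⇒≈0∨≈0 {x} {x} (≈-trans x²≈t t≈0))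
  ... | _ | square t≉0 (u , u²≈t) = trans (Σ-cong two-roots) (trans (Σ-+ (δ u) (δ (- u))) (cong₂ _+_ (Σ-δ u) (Σ-δ (- u))))
    where
    u≉0 : ¬ u ≈ 0ℤ
    u≉0 u≈0 = t≉0 (≈-trans (≈-sym u²≈t) (*-zeroˡ-≈ u u≈0))
    neg-square : ∀ u → - u * - u ≡ u * u
    neg-square = solve-∀
    two-roots : ∀ x → δ t (x * x) ≡ δ u x + δ (- u) x
    two-roots x with x ≈? u | x ≈? - u
    ... | yes x≈u | _ = trans (δ-≈ (≈-trans (*-cong x≈u x≈u) u²≈t))
                              (sym (cong₂ _+_ (δ-≈ x≈u) (δ-≉ (λ x≈-u → u≉-u u≉0 (≈-trans (≈-sym x≈u) x≈-u)))))
    ... | no x≉u | yes x≈-u = trans (δ-≈ (≈-trans (*-cong x≈-u x≈-u) (≈-trans (≈-reflexive (neg-square u)) u²≈t)))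
                                    (sym (cong₂ _+_ (δ-≉ x≉u) (δ-≈ x≈-u)))
    ... | no x≉u | no x≉-u = trans (δ-≉ (λ x²≈t → [ x≉u , x≉-u ] (square-roots (≈-trans x²≈t (≈-sym u²≈t)))))
                                   (sym (cong₂ _+_ (δ-≉ x≉u) (δ-≉ x≉-u)))
  ... | _ | nonsquare _ nsq = trans (Σ-cong (λ x → δ-≉ (λ x²≈t → nsq (x , x²≈t)))) Σ-zero

  Σ-square : ∀ {h} → Congruent _≈_ _≡_ h → Σ (λ x → h (x * x)) ≡ Σ (λ t → (1ℤ + χ t) * h t)
  Σ-square {h} h-cong = begin
    Σ (λ x → h (x * x))                           ≡⟨ Σ-cong (λ x → sym (Σ-δ* (x * x) h-cong)) ⟩
    Σ (λ x → Σ (λ t → δ (x * x) t * h t))         ≡⟨ Σ-comm (λ x t → δ (x * x) t * h t) ⟩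
    Σ (λ t → Σ (λ x → δ (x * x) t * h t))         ≡⟨ Σ-cong (λ t → Σ-*ʳ (h t) (λ x → δ (x * x) t)) ⟩
    Σ (λ t → Σ (λ x → δ (x * x) t) * h t)         ≡⟨ Σ-cong (λ t → cong (_* h t) (roots t)) ⟩
    Σ (λ t → (1ℤ + χ t) * h t)                    ∎
    where
    open ≡-Reasoning
    roots : ∀ t → Σ (λ x → δ (x * x) t) ≡ 1ℤ + χ t
    roots t = trans (Σ-cong (λ x → δ-sym (x * x) t)) (number-of-square-roots t)

  Σχ≡0 : Σ χ ≡ 0ℤ
  Σχ≡0 = +-cancelˡ (+ p) (Σ χ) 0ℤ (begin
    + p + Σ χ                    ≡⟨ cong (_+ Σ χ) (sym (trans (Σ-const 1ℤ) (ℤP.*-identityʳ (+ p)))) ⟩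
    Σ (λ _ → 1ℤ) + Σ χ           ≡⟨ sym (Σ-+ (λ _ → 1ℤ) χ) ⟩
    Σ (λ t → 1ℤ + χ t)           ≡⟨ Σ-cong (λ t → sym (ℤP.*-identityʳ (1ℤ + χ t))) ⟩
    Σ (λ t → (1ℤ + χ t) * 1ℤ)    ≡⟨ sym (Σ-square (λ _ → refl)) ⟩
    Σ (λ _ → 1ℤ)                 ≡⟨ trans (Σ-const 1ℤ) (ℤP.*-identityʳ (+ p)) ⟩
    + p                          ≡⟨ sym (ℤP.+-identityʳ (+ p)) ⟩
    + p + 0ℤ                     ∎)
    where open ≡-Reasoning

  square*nonsquare : ∀ {a b} → ¬ a ≈ 0ℤ → IsSquare a → ¬ IsSquare b → ¬ IsSquare (a * b)
  square*nonsquare {a} {b} a≉0 (u , u²≈a) nsq-b (w , w²≈ab) = nsq-b (w * inverse u , (begin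
    (w * inverse u) * (w * inverse u)           ≡⟨ regroup w (inverse u) ⟩
    (w * w) * (inverse u * inverse u)           ≈⟨ *-congʳ (inverse u * inverse u) (≈-trans w²≈ab (*-congʳ b (≈-sym u²≈a))) ⟩
    ((u * u) * b) * (inverse u * inverse u)     ≡⟨ regroup′ u (inverse u) b ⟩
    ((u * inverse u) * (u * inverse u)) * b     ≈⟨ *-congʳ b (*-cong (*-inverseʳ u≉0) (*-inverseʳ u≉0)) ⟩
    1ℤ * 1ℤ * b                                 ≡⟨ ℤP.*-identityˡ b ⟩
    b                                           ∎))
    where
    open ≈-Reasoning
    u≉0 : ¬ u ≈ 0ℤ
    u≉0 u≈0 = a≉0 (≈-trans (≈-sym u²≈a) (*-zeroˡ-≈ u u≈0))
    regroup : ∀ w v → (w * v) * (w * v) ≡ (w * w) * (v * v)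
    regroup = solve-∀
    regroup′ : ∀ u v b → ((u * u) * b) * (v * v) ≡ ((u * v) * (u * v)) * b
    regroup′ = solve-∀

  -- If a b were a nonsquare for nonsquares a, b, then y ↦ a y would map the
  -- squares and b into nonsquares, forcing Σ χ (a y) < Σ (- χ y) = 0; but Σ χ (a y) = Σ χ = 0.
  nonsquare*nonsquare : ∀ {a b} → ¬ a ≈ 0ℤ → ¬ IsSquare a → ¬ b ≈ 0ℤ → ¬ IsSquare b → IsSquare (a * b)
  nonsquare*nonsquare {a} {b} a≉0 nsq-a b≉0 nsq-b with isSquare? (a * b)
  ... | yes sq = sq
  ... | no nsq-ab = contradiction (subst₂ _≤_ Σχ[ay]≡0 Σbound≡-2 (Σ-mono-≤ pointwise)) (λ ())
    where
    bound : ℤ → ℤ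
    bound y = - χ y + - + 2 * δ b y
    commute : ∀ {y} → ¬ IsSquare (y * a) → ¬ IsSquare (a * y)
    commute {y} nsq sq = nsq (IsSquare-cong (≈-reflexive (ℤP.*-comm a y)) sq)
    pointwise : ∀ y → χ (a * y) ≤ bound y
    pointwise y with χ y | χ-view y
    ... | _ | zero y≈0 = ℤP.≤-reflexive (trans (χ-zero (*-zeroʳ-≈ a y≈0))
            (cong (λ d → - 0ℤ + - + 2 * d) (sym (δ-≉ (λ y≈b → b≉0 (≈-trans (≈-sym y≈b) y≈0))))))
    ... | _ | square y≉0 sq-y = ℤP.≤-reflexive (trans (χ-nonsquare (*-≉0 a≉0 y≉0) (commute (square*nonsquare y≉0 sq-y nsq-a)))
            (cong (λ d → - 1ℤ + - + 2 * d) (sym (δ-≉ (λ y≈b → nsq-b (IsSquare-cong y≈b sq-y))))))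
    ... | _ | nonsquare y≉0 nsq-y with y ≈? b
    ...   | yes y≈b = ℤP.≤-reflexive (trans (χ-cong (*-congˡ a y≈b))
            (trans (χ-nonsquare (*-≉0 a≉0 b≉0) nsq-ab) (cong (λ d → - -1ℤ + - + 2 * d) (sym (δ-≈ y≈b)))))
    ...   | no y≉b = ℤP.≤-trans (χ≤1 (a * y)) (ℤP.≤-reflexive (cong (λ d → - -1ℤ + - + 2 * d) (sym (δ-≉ y≉b))))
    Σχ[ay]≡0 : Σ (λ y → χ (a * y)) ≡ 0ℤ
    Σχ[ay]≡0 = trans (Σ-scale a≉0 χ-cong) Σχ≡0
    Σbound≡-2 : Σ bound ≡ - + 2
    Σbound≡-2 = begin
      Σ bound                                         ≡⟨ Σ-+ (λ y → - χ y) (λ y → - + 2 * δ b y) ⟩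
      Σ (λ y → - χ y) + Σ (λ y → - + 2 * δ b y)       ≡⟨ cong₂ _+_ (trans (Σ-neg χ) (cong -_ Σχ≡0)) (Σ-*ˡ (- + 2) (δ b)) ⟩
      0ℤ + - + 2 * Σ (δ b)                            ≡⟨ cong (λ s → 0ℤ + - + 2 * s) (Σ-δ b) ⟩
      - + 2                                           ∎
      where open ≡-Reasoning

  χ-* : ∀ a b → χ (a * b) ≡ χ a * χ b
  χ-* a b with χ a | χ-view a | χ b | χ-view b
  ... | _ | zero a≈0 | _ | _ = χ-zero (*-zeroˡ-≈ b a≈0)
  ... | _ | square _ _ | _ | zero b≈0 = χ-zero (*-zeroʳ-≈ a b≈0)
  ... | _ | nonsquare _ _ | _ | zero b≈0 = χ-zero (*-zeroʳ-≈ a b≈0)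
  ... | _ | square a≉0 (u , u²≈a) | _ | square b≉0 (v , v²≈b) =
    χ-square (*-≉0 a≉0 b≉0) (u * v , ≈-trans (≈-reflexive (regroup u v)) (*-cong u²≈a v²≈b))
    where
    regroup : ∀ u v → (u * v) * (u * v) ≡ (u * u) * (v * v)
    regroup = solve-∀
  ... | _ | square a≉0 sq-a | _ | nonsquare b≉0 nsq-b = χ-nonsquare (*-≉0 a≉0 b≉0) (square*nonsquare a≉0 sq-a nsq-b)
  ... | _ | nonsquare a≉0 nsq-a | _ | square b≉0 sq-b =
    χ-nonsquare (*-≉0 a≉0 b≉0) (λ sq → square*nonsquare b≉0 sq-b nsq-a (IsSquare-cong (≈-reflexive (ℤP.*-comm a b)) sq))
  ... | _ | nonsquare a≉0 nsq-a | _ | nonsquare b≉0 nsq-b =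
    χ-square (*-≉0 a≉0 b≉0) (nonsquare*nonsquare a≉0 nsq-a b≉0 nsq-b)

  inverse-involution : ∀ {c} → ¬ c ≈ 0ℤ → ∀ t → c * inverse (c * inverse t) ≈ t
  inverse-involution {c} c≉0 t with t ≈? 0ℤ
  ... | yes t≈0 = ≈-trans (≈-reflexive (trans (cong (λ s → c * inverse (c * s)) (inverse-zero t≈0))
                                        (trans (cong (λ s → c * inverse s) (ℤP.*-zeroʳ c))
                                        (trans (cong (c *_) (inverse-zero ≈-refl)) (ℤP.*-zeroʳ c)))))
                          (≈-sym t≈0)
  ... | no t≉0 = begin
    c * inverse w               ≈⟨ *-congʳ (inverse w) (≈-sym wt≈c) ⟩
    w * t * inverse w           ≡⟨ regroup w t (inverse w) ⟩
    t * (w * inverse w)         ≈⟨ *-congˡ t (*-inverseʳ (*-≉0 c≉0 (inverse-≉0 t≉0))) ⟩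
    t * 1ℤ                      ≡⟨ ℤP.*-identityʳ t ⟩
    t                           ∎
    where
    open ≈-Reasoning
    w = c * inverse t
    regroup : ∀ w t i → w * t * i ≡ t * (w * i)
    regroup = solve-∀
    wt≈c : w * t ≈ c
    wt≈c = ≈-trans (≈-reflexive (ℤP.*-assoc c (inverse t) t))
             (≈-trans (*-congˡ c (*-inverseˡ t≉0)) (≈-reflexive (ℤP.*-identityʳ c)))

  χχ-shift-pointwise : ∀ {c} → ¬ c ≈ 0ℤ → ∀ t → χ t * χ (t + c) ≡ χ (1ℤ + c * inverse t) - δ 0ℤ t
  χχ-shift-pointwise {c} c≉0 t with t ≈? 0ℤ
  ... | yes t≈0 = begin
    χ t * χ (t + c)                        ≡⟨ cong (_* χ (t + c)) (χ-zero t≈0) ⟩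
    0ℤ                                     ≡⟨ sym (ℤP.+-inverseʳ 1ℤ) ⟩
    1ℤ - 1ℤ                                ≡⟨ cong₂ _-_ (sym (trans (χ-cong 1+c/0≈1) χ-1)) (sym (δ-≈ t≈0)) ⟩
    χ (1ℤ + c * inverse t) - δ 0ℤ t        ∎
    where
    open ≡-Reasoning
    1+c/0≈1 : 1ℤ + c * inverse t ≈ 1ℤ
    1+c/0≈1 = ≈-trans (+-congˡ 1ℤ (*-zeroʳ-≈ c (≈-reflexive (inverse-zero t≈0)))) (≈-reflexive (ℤP.+-identityʳ 1ℤ))
  ... | no t≉0 = begin
    χ t * χ (t + c)                           ≡⟨ sym (χ-* t (t + c)) ⟩
    χ (t * (t + c))                           ≡⟨ χ-cong (*-congˡ t (+-congˡ t (≈-sym c[t/t]≈c))) ⟩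
    χ (t * (t + c * (t * inverse t)))         ≡⟨ cong χ (sym (factor t c (inverse t))) ⟩
    χ ((t * t) * (1ℤ + c * inverse t))        ≡⟨ χ-* (t * t) (1ℤ + c * inverse t) ⟩
    χ (t * t) * χ (1ℤ + c * inverse t)        ≡⟨ cong (_* χ (1ℤ + c * inverse t)) (χ-u² t≉0) ⟩
    1ℤ * χ (1ℤ + c * inverse t)               ≡⟨ ℤP.*-identityˡ _ ⟩
    χ (1ℤ + c * inverse t)                    ≡⟨ sym (ℤP.+-identityʳ _) ⟩
    χ (1ℤ + c * inverse t) - 0ℤ               ≡⟨ cong (_-_ (χ (1ℤ + c * inverse t))) (sym (δ-≉ t≉0)) ⟩
    χ (1ℤ + c * inverse t) - δ 0ℤ t           ∎
    where
    open ≡-Reasoning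
    factor : ∀ t c i → (t * t) * (1ℤ + c * i) ≡ t * (t + c * (t * i))
    factor = solve-∀
    c[t/t]≈c : c * (t * inverse t) ≈ c
    c[t/t]≈c = ≈-trans (*-congˡ c (*-inverseʳ t≉0)) (≈-reflexive (ℤP.*-identityʳ c))

  Σχ[1+c/t] : ∀ {c} → ¬ c ≈ 0ℤ → Σ (λ t → χ (1ℤ + c * inverse t)) ≡ 0ℤ
  Σχ[1+c/t] {c} c≉0 = begin
    Σ (λ t → χ (1ℤ + c * inverse t))  ≡⟨ Σ-reindex (c/_) (c/_) χ[1+_]-cong c/-cong c/-cong (inverse-involution c≉0) (inverse-involution c≉0) ⟩
    Σ (λ s → χ (1ℤ + s))              ≡⟨ Σ-cong (λ s → cong χ (ℤP.+-comm 1ℤ s)) ⟩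
    Σ (λ s → χ (s + 1ℤ))              ≡⟨ Σ-shift 1ℤ χ-cong ⟩
    Σ χ                               ≡⟨ Σχ≡0 ⟩
    0ℤ                                ∎
    where
    open ≡-Reasoning
    c/_ : ℤ → ℤ
    c/ t = c * inverse t
    c/-cong : Congruent _≈_ _≈_ c/_
    c/-cong t≈s = *-congˡ c (inverse-cong t≈s)
    χ[1+_]-cong : Congruent _≈_ _≡_ (λ s → χ (1ℤ + s))
    χ[1+_]-cong s≈s′ = χ-cong (+-congˡ 1ℤ s≈s′)

  -- For t ≉ 0, χ t χ (t + c) = χ (t² (1 + c/t)) = χ (1 + c/t), and t ↦ c/t permutes the field.
  Σχχ-shift : ∀ {c} → ¬ c ≈ 0ℤ → Σ (λ t → χ t * χ (t + c)) ≡ -1ℤ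
  Σχχ-shift {c} c≉0 = begin
    Σ (λ t → χ t * χ (t + c))                           ≡⟨ Σ-cong (χχ-shift-pointwise c≉0) ⟩
    Σ (λ t → χ (1ℤ + c * inverse t) - δ 0ℤ t)           ≡⟨ Σ-- (λ t → χ (1ℤ + c * inverse t)) (δ 0ℤ) ⟩
    Σ (λ t → χ (1ℤ + c * inverse t)) - Σ (δ 0ℤ)         ≡⟨ cong₂ _-_ (Σχ[1+c/t] c≉0) (Σ-δ 0ℤ) ⟩
    0ℤ - 1ℤ                                             ∎
    where open ≡-Reasoning

  Σχ[x²+c] : ∀ {c} → ¬ c ≈ 0ℤ → Σ (λ x → χ (x * x + c)) ≡ -1ℤ
  Σχ[x²+c] {c} c≉0 = begin
    Σ (λ x → χ (x * x + c))                               ≡⟨ Σ-square (λ t≈s → χ-cong (+-congʳ c t≈s)) ⟩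
    Σ (λ t → (1ℤ + χ t) * χ (t + c))                      ≡⟨ Σ-cong (λ t → ℤP.*-distribʳ-+ (χ (t + c)) 1ℤ (χ t)) ⟩
    Σ (λ t → 1ℤ * χ (t + c) + χ t * χ (t + c))            ≡⟨ Σ-+ (λ t → 1ℤ * χ (t + c)) (λ t → χ t * χ (t + c)) ⟩
    Σ (λ t → 1ℤ * χ (t + c)) + Σ (λ t → χ t * χ (t + c))  ≡⟨ cong₂ _+_ Σχ[t+c] (Σχχ-shift c≉0) ⟩
    0ℤ + -1ℤ                                              ∎
    where
    open ≡-Reasoning
    Σχ[t+c] : Σ (λ t → 1ℤ * χ (t + c)) ≡ 0ℤ
    Σχ[t+c] = trans (Σ-cong (λ t → ℤP.*-identityˡ (χ (t + c)))) (trans (Σ-shift c χ-cong) Σχ≡0)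

  Σχ[ax²+b] : ∀ {a b} → ¬ a ≈ 0ℤ → ¬ b ≈ 0ℤ → Σ (λ x → χ (a * (x * x) + b)) ≡ - χ a
  Σχ[ax²+b] {a} {b} a≉0 b≉0 = begin
    Σ (λ x → χ (a * (x * x) + b))                  ≡⟨ Σ-cong (λ x → trans (χ-cong (factor x)) (χ-* a _)) ⟩
    Σ (λ x → χ a * χ (x * x + b * inverse a))      ≡⟨ Σ-*ˡ (χ a) (λ x → χ (x * x + b * inverse a)) ⟩
    χ a * Σ (λ x → χ (x * x + b * inverse a))      ≡⟨ cong (χ a *_) (Σχ[x²+c] (*-≉0 b≉0 (inverse-≉0 a≉0))) ⟩
    χ a * -1ℤ                                      ≡⟨ trans (ℤP.*-comm (χ a) -1ℤ) (ℤP.-1*i≡-i (χ a)) ⟩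
    - χ a                                          ∎
    where
    open ≡-Reasoning
    expand : ∀ a x b i → a * (x * x + b * i) ≡ a * (x * x) + (a * i) * b
    expand = solve-∀
    factor : ∀ x → a * (x * x) + b ≈ a * (x * x + b * inverse a)
    factor x = ≈-sym (≈-trans (≈-reflexive (expand a x b (inverse a)))
                 (+-congˡ (a * (x * x)) (≈-trans (*-congʳ b (*-inverseʳ a≉0)) (≈-reflexive (ℤP.*-identityˡ b)))))

-- Pell numbers modulo a prime p ≥ 7

P : ℕ → ℤ
P n = + pell n

PellLike : (ℕ → ℤ) → Set
PellLike S = ∀ n → S (suc (suc n)) ≡ + 2 * S (suc n) + S n

P-pellLike : PellLike P
P-pellLike n = trans (ℤP.pos-+ (2 ℕ.* pell (suc n)) (pell n)) (cong (_+ P n) (ℤP.pos-* 2 (pell (suc n))))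

-- P (n + 1) - P n + P n √2 = (1 + √2)ⁿ, and this is its norm.
pell-norm : ℕ → ℤ
pell-norm n = (P (suc n) - P n) * (P (suc n) - P n) - + 2 * (P n * P n)

pell-norm-suc : ∀ n → pell-norm (suc n) ≡ - pell-norm n
pell-norm-suc n = trans (cong (λ z → (z - P (suc n)) * (z - P (suc n)) - + 2 * (P (suc n) * P (suc n))) (P-pellLike n))
                        (step (P n) (P (suc n)))
  where
  step : ∀ x y → ((+ 2 * y + x) - y) * ((+ 2 * y + x) - y) - + 2 * (y * y) ≡ - ((y - x) * (y - x) - + 2 * (x * x))
  step = solve-∀

pell-norm≡±1 : ∀ n → pell-norm n ≡ 1ℤ ⊎ pell-norm n ≡ -1ℤ
pell-norm≡±1 zero = inj₁ refl
pell-norm≡±1 (suc n) with pell-norm≡±1 n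
... | inj₁ N≡1 = inj₂ (trans (pell-norm-suc n) (cong -_ N≡1))
... | inj₂ N≡-1 = inj₁ (trans (pell-norm-suc n) (cong -_ N≡-1))

a-s≡c⇒a≡s+c : ∀ {a s c} → a - s ≡ c → a ≡ s + c
a-s≡c⇒a≡s+c {a} {s} eq = trans (split a s) (cong (_+_ s) eq)
  where
  split : ∀ a s → a ≡ s + (a - s)
  split = solve-∀

2P²±1-square : ∀ n → (∃ λ u → u * u ≡ + 2 * (P n * P n) + 1ℤ) ⊎ (∃ λ u → u * u ≡ + 2 * (P n * P n) + -1ℤ)
2P²±1-square n with pell-norm≡±1 n
... | inj₁ N≡1 = inj₁ (P (suc n) - P n , a-s≡c⇒a≡s+c N≡1)
... | inj₂ N≡-1 = inj₂ (P (suc n) - P n , a-s≡c⇒a≡s+c N≡-1)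

module PellModuloLargePrime (p : ℕ) (p-prime : Prime p) (7≤p : 7 ℕ.≤ p) where

  open QuadraticCharacter p p-prime (ℕP.<-≤-trans (ℕP.<ᵇ⇒< 2 7 _) 7≤p)

  literal≉0 : ∀ k → {True (1 ℕ.≤? k)} → {True (k ℕ.<? 7)} → ¬ + k ≈ 0ℤ
  literal≉0 k {0<k} {k<7} = small≉0 (toWitness 0<k) (ℕP.<-≤-trans (toWitness k<7) 7≤p)

  -1≉0 : ¬ -1ℤ ≈ 0ℤ
  -1≉0 -1≈0 = 1≉0 (-‿cong -1≈0)

  -1≤χ*χ : ∀ a b → -1ℤ ≤ χ a * χ b
  -1≤χ*χ a b = subst (-1ℤ ≤_) (χ-* a b) (-1≤χ (a * b))

  -- D x = 4 if 2x² + 1 and 2x² - 1 are both non-squares, and D x = 0 otherwise (D≡0).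
  A B H : ℤ → ℤ
  A x = χ (+ 2 * (x * x) + 1ℤ)
  B x = χ (+ 2 * (x * x) + -1ℤ)
  H t = χ (+ 4 * (t * t) + -1ℤ)

  D f : ℤ → ℤ
  D x = (1ℤ - A x) * (1ℤ - B x)
  f t = 1ℤ + χ t * H t

  A-cong : Congruent _≈_ _≡_ A
  A-cong e = χ-cong (+-congʳ 1ℤ (*-congˡ (+ 2) (*-cong e e)))

  B-cong : Congruent _≈_ _≡_ B
  B-cong e = χ-cong (+-congʳ -1ℤ (*-congˡ (+ 2) (*-cong e e)))

  H-cong : Congruent _≈_ _≡_ H
  H-cong e = χ-cong (+-congʳ -1ℤ (*-congˡ (+ 4) (*-cong e e)))

  f-cong : Congruent _≈_ _≡_ f
  f-cong e = cong₂ (λ u v → 1ℤ + u * v) (χ-cong e) (H-cong e)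

  f-nonneg : ∀ t → 0ℤ ≤ f t
  f-nonneg t = ℤP.+-monoʳ-≤ 1ℤ (-1≤χ*χ t (+ 4 * (t * t) + -1ℤ))

  χ4≡1 : χ (+ 4) ≡ 1ℤ
  χ4≡1 = χ-u² 2≉0

  Σ[AB]≡-1+Σ[χH] : Σ (λ x → A x * B x) ≡ -1ℤ + Σ (λ t → χ t * H t)
  Σ[AB]≡-1+Σ[χH] = begin
    Σ (λ x → A x * B x)                             ≡⟨ Σ-cong (λ x → trans (sym (χ-* (+ 2 * (x * x) + 1ℤ) (+ 2 * (x * x) + -1ℤ))) (cong χ (2x²±1-product x))) ⟩
    Σ (λ x → H (x * x))                             ≡⟨ Σ-square H-cong ⟩
    Σ (λ t → (1ℤ + χ t) * H t)                      ≡⟨ Σ-cong (λ t → ℤP.*-distribʳ-+ (H t) 1ℤ (χ t)) ⟩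
    Σ (λ t → 1ℤ * H t + χ t * H t)                  ≡⟨ Σ-+ (λ t → 1ℤ * H t) (λ t → χ t * H t) ⟩
    Σ (λ t → 1ℤ * H t) + Σ (λ t → χ t * H t)        ≡⟨ cong (_+ Σ (λ t → χ t * H t)) ΣH ⟩
    -1ℤ + Σ (λ t → χ t * H t)                       ∎
    where
    open ≡-Reasoning
    2x²±1-product : ∀ x → (+ 2 * (x * x) + 1ℤ) * (+ 2 * (x * x) + -1ℤ) ≡ + 4 * ((x * x) * (x * x)) + -1ℤ
    2x²±1-product = solve-∀
    ΣH : Σ (λ t → 1ℤ * H t) ≡ -1ℤ
    ΣH = trans (Σ-cong (λ t → ℤP.*-identityˡ (H t))) (trans (Σχ[ax²+b] (literal≉0 4) -1≉0) (cong -_ χ4≡1))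

  Σf≡p+Σ[χH] : Σ f ≡ + p + Σ (λ t → χ t * H t)
  Σf≡p+Σ[χH] = trans (Σ-+ (λ _ → 1ℤ) (λ t → χ t * H t)) (cong (_+ Σ (λ t → χ t * H t)) (trans (Σ-const 1ℤ) (ℤP.*-identityʳ (+ p))))

  ΣD≡Σf+[2χ2-1] : Σ D ≡ Σ f + (χ (+ 2) + χ (+ 2) + -1ℤ)
  ΣD≡Σf+[2χ2-1] = begin
    Σ D                                                   ≡⟨ Σ-cong (λ x → expand (A x) (B x)) ⟩
    Σ (λ x → 1ℤ - A x - B x + A x * B x)                  ≡⟨ Σ-+ (λ x → 1ℤ - A x - B x) (λ x → A x * B x) ⟩
    Σ (λ x → 1ℤ - A x - B x) + Σ (λ x → A x * B x)        ≡⟨ cong (_+ Σ (λ x → A x * B x)) (trans (Σ-- (λ x → 1ℤ - A x) B) (cong (_- Σ B) (Σ-- (λ _ → 1ℤ) A))) ⟩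
    Σ (λ _ → 1ℤ) - Σ A - Σ B + Σ (λ x → A x * B x)        ≡⟨ cong₂ _+_ (cong₂ _-_ (cong₂ _-_ (trans (Σ-const 1ℤ) (ℤP.*-identityʳ (+ p))) ΣA) ΣB) Σ[AB]≡-1+Σ[χH] ⟩
    + p - - χ (+ 2) - - χ (+ 2) + (-1ℤ + S)               ≡⟨ regroup (+ p) (χ (+ 2)) S ⟩
    (+ p + S) + (χ (+ 2) + χ (+ 2) + -1ℤ)                 ≡⟨ cong (_+ (χ (+ 2) + χ (+ 2) + -1ℤ)) (sym Σf≡p+Σ[χH]) ⟩
    Σ f + (χ (+ 2) + χ (+ 2) + -1ℤ)                       ∎
    where
    open ≡-Reasoning
    S = Σ (λ t → χ t * H t)
    expand : ∀ a b → (1ℤ - a) * (1ℤ - b) ≡ 1ℤ - a - b + a * b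
    expand = solve-∀
    regroup : ∀ P c S → P - - c - - c + (-1ℤ + S) ≡ (P + S) + (c + c + -1ℤ)
    regroup = solve-∀
    ΣA : Σ A ≡ - χ (+ 2)
    ΣA = Σχ[ax²+b] 2≉0 1≉0
    ΣB : Σ B ≡ - χ (+ 2)
    ΣB = Σχ[ax²+b] 2≉0 -1≉0

  2x²±1-sum : ∀ x → (+ 2 * x) * (+ 2 * x) ≡ (+ 2 * (x * x) + -1ℤ) + (+ 2 * (x * x) + 1ℤ)
  2x²±1-sum = solve-∀

  2x²±1-difference : ∀ x → (+ 2 * (x * x) + 1ℤ) - (+ 2 * (x * x) + -1ℤ) ≡ + 2
  2x²±1-difference = solve-∀

  -- If 2x² + 1 ≡ 0 then 2x² - 1 ≡ (2x)², and if 2x² - 1 ≡ 0 then 2x² + 1 ≡ (2x)².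
  D≡0 : ∀ x → ¬ (A x ≡ -1ℤ × B x ≡ -1ℤ) → D x ≡ 0ℤ
  D≡0 x not-both with A x | χ-view (+ 2 * (x * x) + 1ℤ) | B x | χ-view (+ 2 * (x * x) + -1ℤ)
  ... | _ | square _ _ | b | _ = ℤP.*-zeroˡ (1ℤ - b)
  ... | a | _ | _ | square _ _ = ℤP.*-zeroʳ (1ℤ - a)
  ... | _ | zero +≈0 | _ | zero -≈0 = contradiction (≈-trans (≈-reflexive (sym (2x²±1-difference x))) (≈⇒-≈0 (≈-trans +≈0 (≈-sym -≈0)))) 2≉0
  ... | _ | zero +≈0 | _ | nonsquare _ nsq = contradiction (+ 2 * x , ≈-trans (≈-reflexive (2x²±1-sum x))
        (≈-trans (+-congˡ (+ 2 * (x * x) + -1ℤ) +≈0) (≈-reflexive (ℤP.+-identityʳ _)))) nsq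
  ... | _ | nonsquare _ nsq | _ | zero -≈0 = contradiction (+ 2 * x , ≈-trans (≈-reflexive (2x²±1-sum x))
        (≈-trans (+-congʳ (+ 2 * (x * x) + 1ℤ) -≈0) (≈-reflexive (ℤP.+-identityˡ _)))) nsq
  ... | _ | nonsquare _ _ | _ | nonsquare _ _ = contradiction (refl , refl) not-both

  ½ : ℤ
  ½ = inverse (+ 2)

  ½≉0 : ¬ ½ ≈ 0ℤ
  ½≉0 = inverse-≉0 2≉0

  2*½≈1 : + 2 * ½ ≈ 1ℤ
  2*½≈1 = *-inverseʳ 2≉0

  4½²-1≈0 : + 4 * (½ * ½) + -1ℤ ≈ 0ℤ
  4½²-1≈0 = ≈-trans (≈-reflexive (regroup ½)) (≈⇒-≈0 (*-cong 2*½≈1 2*½≈1))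
    where
    regroup : ∀ h → + 4 * (h * h) + -1ℤ ≡ (+ 2 * h) * (+ 2 * h) - 1ℤ
    regroup = solve-∀

  -- f is 1 at 0 and at ½, where one factor of χ t * χ (4 t² - 1) vanishes.
  Σf≥2+f : ∀ {y} → ¬ y ≈ 0ℤ → ¬ y ≈ ½ → + 2 + f y ≤ Σ f
  Σf≥2+f {y} y≉0 y≉½ = subst (_≤ Σ f) (cong₂ (λ u v → u + v + f y) f0≡1 f½≡1)
    (Σ-≥-three f-cong f-nonneg (½≉0 ∘ ≈-sym) (y≉0 ∘ ≈-sym) (y≉½ ∘ ≈-sym))
    where
    f0≡1 : f 0ℤ ≡ 1ℤ
    f0≡1 = cong (λ c → 1ℤ + c * H 0ℤ) (χ-zero ≈-refl)
    f½≡1 : f ½ ≡ 1ℤ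
    f½≡1 = trans (cong (λ c → 1ℤ + χ ½ * c) (χ-zero 4½²-1≈0)) (cong (_+_ 1ℤ) (ℤP.*-zeroʳ (χ ½)))

  χ½≡-1 : χ (+ 2) ≡ -1ℤ → χ ½ ≡ -1ℤ
  χ½≡-1 χ2≡-1 = begin
    χ ½                   ≡⟨ sym (ℤP.neg-involutive (χ ½)) ⟩
    - - χ ½               ≡⟨ cong -_ (sym (ℤP.-1*i≡-i (χ ½))) ⟩
    - (-1ℤ * χ ½)         ≡⟨ cong (λ c → - (c * χ ½)) (sym χ2≡-1) ⟩
    - (χ (+ 2) * χ ½)     ≡⟨ cong -_ (sym (χ-* (+ 2) ½)) ⟩
    - χ (+ 2 * ½)         ≡⟨ cong -_ (trans (χ-cong 2*½≈1) χ-1) ⟩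
    -1ℤ                   ∎
    where open ≡-Reasoning

  -- 4 (5/2)² - 1 = 24
  H[5½]≡-χ3 : χ (+ 2) ≡ -1ℤ → H (+ 5 * ½) ≡ - χ (+ 3)
  H[5½]≡-χ3 χ2≡-1 = begin
    H (+ 5 * ½)                        ≡⟨ χ-cong 24≈ ⟩
    χ (+ 4 * (+ 2 * + 3))              ≡⟨ χ-* (+ 4) (+ 2 * + 3) ⟩
    χ (+ 4) * χ (+ 2 * + 3)            ≡⟨ cong₂ _*_ χ4≡1 (χ-* (+ 2) (+ 3)) ⟩
    1ℤ * (χ (+ 2) * χ (+ 3))           ≡⟨ cong (λ c → 1ℤ * (c * χ (+ 3))) χ2≡-1 ⟩
    1ℤ * (-1ℤ * χ (+ 3))               ≡⟨ trans (ℤP.*-identityˡ _) (ℤP.-1*i≡-i (χ (+ 3))) ⟩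
    - χ (+ 3)                          ∎
    where
    open ≡-Reasoning
    regroup : ∀ h → + 4 * ((+ 5 * h) * (+ 5 * h)) + -1ℤ ≡ + 25 * (+ 4 * (h * h) + -1ℤ) + + 24
    regroup = solve-∀
    24≈ : + 4 * ((+ 5 * ½) * (+ 5 * ½)) + -1ℤ ≈ + 4 * (+ 2 * + 3)
    24≈ = ≈-trans (≈-reflexive (regroup ½))
            (≈-trans (+-congʳ (+ 24) (*-zeroʳ-≈ (+ 25) 4½²-1≈0)) ≈-refl)

  -- Besides 0 and ½, f takes the value 2 at 2 or at 5/2, according to the value of χ 15.
  Σf≥4 : χ (+ 2) ≡ -1ℤ → + 4 ≤ Σ f
  Σf≥4 χ2≡-1 with χ-values (+ 15)
  ... | inj₁ χ15≡0 = contradiction (χ≡0⇒≈0 χ15≡0) (*-≉0 (literal≉0 3) (literal≉0 5))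
  ... | inj₂ (inj₂ χ15≡-1) = subst (_≤ Σ f) (cong (_+_ (+ 2)) f2≡2) (Σf≥2+f (literal≉0 2) 2≉½)
    where
    f2≡2 : f (+ 2) ≡ + 2
    f2≡2 = cong₂ (λ u v → 1ℤ + u * v) χ2≡-1 χ15≡-1
    2≉½ : ¬ + 2 ≈ ½
    2≉½ 2≈½ = literal≉0 3 (≈⇒-≈0 (≈-trans (*-congˡ (+ 2) 2≈½) 2*½≈1))
  ... | inj₂ (inj₁ χ15≡1) = subst (_≤ Σ f) (cong (_+_ (+ 2)) f5½≡2) (Σf≥2+f 5½≉0 5½≉½)
    where
    5½≉0 : ¬ + 5 * ½ ≈ 0ℤ
    5½≉0 = *-≉0 (literal≉0 5) ½≉0
    5½≉½ : ¬ + 5 * ½ ≈ ½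
    5½≉½ 5½≈½ = *-≉0 (literal≉0 4) ½≉0 (≈-trans (≈-reflexive (sym (four ½))) (≈⇒-≈0 5½≈½))
      where
      four : ∀ h → + 5 * h - h ≡ + 4 * h
      four = solve-∀
    regroup : ∀ c₃ c₅ → (c₅ * -1ℤ) * - c₃ ≡ c₃ * c₅
    regroup = solve-∀
    f5½≡2 : f (+ 5 * ½) ≡ + 2
    f5½≡2 = cong (_+_ 1ℤ) (begin
      χ (+ 5 * ½) * H (+ 5 * ½)              ≡⟨ cong₂ _*_ (χ-* (+ 5) ½) (H[5½]≡-χ3 χ2≡-1) ⟩
      (χ (+ 5) * χ ½) * - χ (+ 3)            ≡⟨ cong (λ c → (χ (+ 5) * c) * - χ (+ 3)) (χ½≡-1 χ2≡-1) ⟩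
      (χ (+ 5) * -1ℤ) * - χ (+ 3)            ≡⟨ regroup (χ (+ 3)) (χ (+ 5)) ⟩
      χ (+ 3) * χ (+ 5)                      ≡⟨ sym (χ-* (+ 3) (+ 5)) ⟩
      χ (+ 15)                               ≡⟨ χ15≡1 ⟩
      1ℤ                                     ∎)
      where open ≡-Reasoning

  -- Σ D = Σ f + 2 χ 2 - 1 with Σ f ≥ 0, and Σ f ≥ 4 when χ 2 = -1, so Σ D > 0.
  D≢0 : ¬ (∀ x → D x ≡ 0ℤ)
  D≢0 D≡0 = by-cases (χ-values (+ 2))
    where
    k = χ (+ 2) + χ (+ 2) + -1ℤ
    Σf+k≡0 : Σ f + k ≡ 0ℤ
    Σf+k≡0 = trans (sym ΣD≡Σf+[2χ2-1]) (trans (Σ-cong D≡0) Σ-zero)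
    too-big : ∀ {m} → m ≤ Σ f → m + k ≡ 1ℤ → ⊥
    too-big m≤Σf m+k≡1 = contradiction (subst₂ _≤_ m+k≡1 Σf+k≡0 (ℤP.+-monoˡ-≤ k m≤Σf)) λ { (ℤ.+≤+ ()) }
    by-cases : χ (+ 2) ≡ 0ℤ ⊎ χ (+ 2) ≡ 1ℤ ⊎ χ (+ 2) ≡ -1ℤ → ⊥
    by-cases (inj₁ χ2≡0) = 2≉0 (χ≡0⇒≈0 χ2≡0)
    by-cases (inj₂ (inj₁ χ2≡1)) = too-big (Σ-nonneg f-nonneg) (cong (λ c → 0ℤ + (c + c + -1ℤ)) χ2≡1)
    by-cases (inj₂ (inj₂ χ2≡-1)) = too-big (Σf≥4 χ2≡-1) (cong (λ c → + 4 + (c + c + -1ℤ)) χ2≡-1)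

  double-nonsquare : ∃ λ r → r ℕ.< p × A (+ r) ≡ -1ℤ × B (+ r) ≡ -1ℤ
  double-nonsquare with FinP.any? (λ i → (A (element i) ℤP.≟ -1ℤ) ×-dec (B (element i) ℤP.≟ -1ℤ))
  ... | yes (i , A≡-1 , B≡-1) = toℕ i , FinP.toℕ<n i , A≡-1 , B≡-1
  ... | no none = contradiction (λ x → D≡0 x (λ (A≡-1 , B≡-1) → none (toFin x ,
          trans (A-cong (element-toFin x)) A≡-1 , trans (B-cong (element-toFin x)) B≡-1))) D≢0

  pell-avoids : ∀ n → ¬ (A (P n) ≡ -1ℤ × B (P n) ≡ -1ℤ)
  pell-avoids n (A≡-1 , B≡-1) with 2P²±1-square n
  ... | inj₁ (u , u²≡) = χ-square⇒≢-1 (u , ≈-reflexive u²≡) A≡-1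
  ... | inj₂ (u , u²≡) = χ-square⇒≢-1 (u , ≈-reflexive u²≡) B≡-1

  pell-misses-residue : ∃ λ r → r ℕ.< p × ∀ n → pell n ℕ.% p ≢ r
  pell-misses-residue with double-nonsquare
  ... | r , r<p , A≡-1 , B≡-1 = r , r<p , misses
    where
    misses : ∀ n → pell n ℕ.% p ≢ r
    misses n Pn≡r = pell-avoids n (trans (A-cong Pn≈r) A≡-1 , trans (B-cong Pn≈r) B≡-1)
      where
      Pn≈r : P n ≈ + r
      Pn≈r = %ℕ≡⇒≈ (trans Pn≡r (sym (ℕD.m<n⇒m%n≡m r<p)))

-- Completeness modulo powers of 3 and 5

-- P′ m = P (m - 1) for m ≥ 1.
P′ : ℕ → ℤ
P′ m = P (suc m) - + 2 * P m

pellLike-+ : ∀ {S} → PellLike S → ∀ m n → S (m ℕ.+ n) ≡ P m * S (suc n) + P′ m * S n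
pellLike-+ {S} S-rec zero n = initial (S (suc n)) (S n)
  where
  initial : ∀ a b → b ≡ 0ℤ * a + (1ℤ - + 2 * 0ℤ) * b
  initial = solve-∀
pellLike-+ {S} S-rec (suc zero) n = initial (S (suc n)) (S n)
  where
  initial : ∀ a b → a ≡ 1ℤ * a + (+ 2 - + 2 * 1ℤ) * b
  initial = solve-∀
pellLike-+ {S} S-rec (suc (suc m)) n = begin
  S (suc (suc (m ℕ.+ n)))                                        ≡⟨ S-rec (m ℕ.+ n) ⟩
  + 2 * S (suc m ℕ.+ n) + S (m ℕ.+ n)                            ≡⟨ cong₂ (λ u v → + 2 * u + v) (pellLike-+ {S} S-rec (suc m) n) (pellLike-+ {S} S-rec m n) ⟩
  + 2 * (P (suc m) * a + P′ (suc m) * b) + (P m * a + P′ m * b)  ≡⟨ step (P-pellLike m) (P-pellLike (suc m)) ⟩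
  P (suc (suc m)) * a + P′ (suc (suc m)) * b                     ∎
  where
  open ≡-Reasoning
  a = S (suc n)
  b = S n
  step : ∀ {p₀ p₁ p₂ p₃} → p₂ ≡ + 2 * p₁ + p₀ → p₃ ≡ + 2 * p₂ + p₁ →
         + 2 * (p₁ * a + (p₂ - + 2 * p₁) * b) + (p₀ * a + (p₁ - + 2 * p₀) * b) ≡ p₂ * a + (p₃ - + 2 * p₂) * b
  step {p₀} {p₁} refl refl = identity p₀ p₁ a b
    where
    identity : ∀ p₀ p₁ a b → + 2 * (p₁ * a + ((+ 2 * p₁ + p₀) - + 2 * p₁) * b) + (p₀ * a + (p₁ - + 2 * p₀) * b)
                           ≡ (+ 2 * p₁ + p₀) * a + ((+ 2 * (+ 2 * p₁ + p₀) + p₁) - + 2 * (+ 2 * p₁ + p₀)) * b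
    identity = solve-∀

pellLike-combination : ∀ U V S → PellLike S → PellLike (λ n → U * S (suc n) + V * S n)
pellLike-combination U V S S-rec n =
  trans (cong₂ (λ a b → U * a + V * b) (S-rec (suc n)) (S-rec n)) (regroup U V (S (suc (suc n))) (S (suc n)) (S n))
  where
  regroup : ∀ U V a b c → U * (+ 2 * a + b) + V * (+ 2 * b + c) ≡ + 2 * (U * a + V * b) + (U * b + V * c)
  regroup = solve-∀

triangle : ℕ → ℤ
triangle zero = 0ℤ
triangle (suc k) = triangle k + + k

module Period (T : ℕ) (M U V : ℤ) (P-T : P T ≡ M * U) (P′-T : P′ T ≡ 1ℤ + M * V) where

  L : (ℕ → ℤ) → ℕ → ℤ
  L S n = U * S (suc n) + V * S n

  L-pellLike : ∀ S → PellLike S → PellLike (L S)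
  L-pellLike = pellLike-combination U V

  shift : ∀ S → PellLike S → ∀ n → S (T ℕ.+ n) ≡ S n + M * L S n
  shift S S-rec n = trans (pellLike-+ {S} S-rec T n)
    (trans (cong₂ (λ u v → u * S (suc n) + v * S n) P-T P′-T) (regroup M U V (S (suc n)) (S n)))
    where
    regroup : ∀ M U V a b → M * U * a + (1ℤ + M * V) * b ≡ b + M * (U * a + V * b)
    regroup = solve-∀

  shift-suc : ∀ S → PellLike S → ∀ k n → S (suc k ℕ.* T ℕ.+ n) ≡ S (k ℕ.* T ℕ.+ n) + M * L S (k ℕ.* T ℕ.+ n)
  shift-suc S S-rec k n = trans (cong S (ℕP.+-assoc T (k ℕ.* T) n)) (shift S S-rec (k ℕ.* T ℕ.+ n))

  -- The first terms of the binomial expansion of S (k T + n) = ((1 + M L)ᵏ S) n.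
  iterate₁ : ∀ S → PellLike S → ∀ k n → S (k ℕ.* T ℕ.+ n) ≡ S n mod M
  iterate₁ S S-rec zero n = ≈-refl
    where open Congruence M
  iterate₁ S S-rec (suc k) n = begin
    S (suc k ℕ.* T ℕ.+ n)                           ≡⟨ shift-suc S S-rec k n ⟩
    S (k ℕ.* T ℕ.+ n) + M * L S (k ℕ.* T ℕ.+ n)     ≈⟨ +-cong (iterate₁ S S-rec k n) (m*x≈0 (L S (k ℕ.* T ℕ.+ n))) ⟩
    S n + 0ℤ                                        ≡⟨ ℤP.+-identityʳ (S n) ⟩
    S n                                             ∎
    where
    open Congruence M
    open ≈-Reasoning

  iterate₂ : ∀ S → PellLike S → ∀ k n → S (k ℕ.* T ℕ.+ n) ≡ S n + + k * M * L S n mod M * M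
  iterate₂ S S-rec zero n = ≈-reflexive (sym (vanish (S n) M (L S n)))
    where
    open Congruence (M * M)
    vanish : ∀ s M l → s + 0ℤ * M * l ≡ s
    vanish = solve-∀
  iterate₂ S S-rec (suc k) n = begin
    S (suc k ℕ.* T ℕ.+ n)                                   ≡⟨ shift-suc S S-rec k n ⟩
    S (k ℕ.* T ℕ.+ n) + M * L S (k ℕ.* T ℕ.+ n)             ≈⟨ +-cong (iterate₂ S S-rec k n) (≡-mod-scale M (iterate₁ (L S) (L-pellLike S S-rec) k n)) ⟩
    S n + + k * M * L S n + M * L S n                       ≡⟨ regroup (S n) (+ k) M (L S n) ⟩
    S n + (1ℤ + + k) * M * L S n                            ≡⟨ cong (λ c → S n + c * M * L S n) (sym (ℤP.pos-+ 1 k)) ⟩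
    S n + + suc k * M * L S n                               ∎
    where
    open Congruence (M * M)
    open ≈-Reasoning
    regroup : ∀ s k M l → s + k * M * l + M * l ≡ s + (1ℤ + k) * M * l
    regroup = solve-∀

  iterate₃ : ∀ S → PellLike S → ∀ k n →
    S (k ℕ.* T ℕ.+ n) ≡ S n + + k * M * L S n + triangle k * (M * M) * L (L S) n mod M * (M * M)
  iterate₃ S S-rec zero n = ≈-reflexive (sym (vanish (S n) M (L S n) (L (L S) n)))
    where
    open Congruence (M * (M * M))
    vanish : ∀ s M l l′ → s + 0ℤ * M * l + 0ℤ * (M * M) * l′ ≡ s
    vanish = solve-∀
  iterate₃ S S-rec (suc k) n = begin
    S (suc k ℕ.* T ℕ.+ n)                                                     ≡⟨ shift-suc S S-rec k n ⟩
    S (k ℕ.* T ℕ.+ n) + M * L S (k ℕ.* T ℕ.+ n)                               ≈⟨ +-cong (iterate₃ S S-rec k n) (≡-mod-scale M (iterate₂ (L S) (L-pellLike S S-rec) k n)) ⟩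
    S n + + k * M * L S n + triangle k * (M * M) * L (L S) n + M * (L S n + + k * M * L (L S) n)
                                                                              ≡⟨ regroup (S n) (+ k) (triangle k) M (L S n) (L (L S) n) ⟩
    S n + (1ℤ + + k) * M * L S n + (triangle k + + k) * (M * M) * L (L S) n   ≡⟨ cong (λ c → S n + c * M * L S n + triangle (suc k) * (M * M) * L (L S) n) (sym (ℤP.pos-+ 1 k)) ⟩
    S n + + suc k * M * L S n + triangle (suc k) * (M * M) * L (L S) n        ∎
    where
    open Congruence (M * (M * M))
    open ≈-Reasoning
    regroup : ∀ s k t M l l′ → s + k * M * l + t * (M * M) * l′ + M * (l + k * M * l′)
                             ≡ s + (1ℤ + k) * M * l + (t + k) * (M * M) * l′
    regroup = solve-∀

pos-^ : ∀ q a → + (q ^ a) ≡ (+ q) ℤ.^ a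
pos-^ q zero = refl
pos-^ q (suc a) = trans (ℤP.pos-* q (q ^ a)) (cong (+ q *_) (pos-^ q a))

≡-mod-lift : ∀ {Q N x u} → x ≡ N * u mod Q * N → ∃ λ u′ → (x ≡ N * u′) × (u′ ≡ u mod Q)
≡-mod-lift {Q} {N} {x} {u} x≡Nu with ≡-mod⇒∃ x≡Nu
... | k , x≡Nu+kQN = u + k * Q , trans x≡Nu+kQN (regroup N u k Q) , u+kQ≡u
  where
  open Congruence Q
  regroup : ∀ N u k Q → N * u + k * (Q * N) ≡ N * (u + k * Q)
  regroup = solve-∀
  u+kQ≡u : u + k * Q ≈ u
  u+kQ≡u = ≈-trans (+-congˡ u (≈-trans (≈-reflexive (ℤP.*-comm k Q)) (m*x≈0 k))) (≈-reflexive (ℤP.+-identityʳ u))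

module Lifting (q : ℕ) (q-prime : Prime q) (T₀ : ℕ) (u₀ v₀ : ℤ)
               (P-T₀ : P T₀ ≡ + q * u₀) (P′-T₀ : P′ T₀ ≡ 1ℤ + + q * v₀) (q∣triangle : + q ∣ triangle q) where

  Q : ℤ
  Q = + q

  module Mod-q = Congruence Q

  Q∣Q^[1+a] : ∀ a → Q ∣ Q ℤ.^ suc a
  Q∣Q^[1+a] a = divides (Q ℤ.^ a) (ℤP.*-comm Q (Q ℤ.^ a))

  G : ℕ → ℤ
  G n = u₀ * P (suc n) + v₀ * P n

  G-pellLike : PellLike G
  G-pellLike = pellLike-combination u₀ v₀ P P-pellLike

  record PeriodAt (a : ℕ) : Set where
    field
      T : ℕ
      U V : ℤ
      P-T : P T ≡ Q ℤ.^ suc a * U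
      P′-T : P′ T ≡ 1ℤ + Q ℤ.^ suc a * V
      U≡u₀ : U ≡ u₀ mod Q
      V≡v₀ : V ≡ v₀ mod Q

  period₀ : PeriodAt 0
  period₀ = record
    { T = T₀ ; U = u₀ ; V = v₀
    ; P-T = trans P-T₀ (cong (_* u₀) (sym (ℤP.*-identityʳ Q)))
    ; P′-T = trans P′-T₀ (cong (λ c → 1ℤ + c * v₀) (sym (ℤP.*-identityʳ Q)))
    ; U≡u₀ = Mod-q.≈-refl ; V≡v₀ = Mod-q.≈-refl }

  module AtPeriod {a} (π : PeriodAt a) where
    open PeriodAt π public

    M : ℤ
    M = Q ℤ.^ suc a

    open Period T M U V P-T P′-T public

    -- The quadratic term of the expansion drops out because q ∣ q (q - 1) / 2.
    q-fold-shift : ∀ S → PellLike S → ∀ n → S (q ℕ.* T ℕ.+ n) ≡ S n + Q * M * L S n mod Q * (Q * M)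
    q-fold-shift S S-rec n = begin
      S (q ℕ.* T ℕ.+ n)                                               ≈⟨ ≡-mod-weaken Q²M∣M³ (iterate₃ S S-rec q n) ⟩
      S n + Q * M * L S n + triangle q * (M * M) * L (L S) n          ≈⟨ +-congˡ (S n + Q * M * L S n) quadratic≈0 ⟩
      S n + Q * M * L S n + 0ℤ                                        ≡⟨ ℤP.+-identityʳ _ ⟩
      S n + Q * M * L S n                                             ∎
      where
      open Congruence (Q * (Q * M))
      open ≈-Reasoning
      Q^a = Q ℤ.^ a
      c = quotient q∣triangle
      cube : ∀ Q e → (Q * e) * ((Q * e) * (Q * e)) ≡ (e * e) * (Q * (Q * (Q * e)))
      cube = solve-∀
      Q²M∣M³ : Q * (Q * M) ∣ M * (M * M)
      Q²M∣M³ = divides (Q^a * Q^a) (cube Q Q^a)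
      quadratic : ∀ c Q e l → c * Q * ((Q * e) * (Q * e)) * l ≡ (c * e * l) * (Q * (Q * (Q * e)))
      quadratic = solve-∀
      quadratic≈0 : triangle q * (M * M) * L (L S) n ≈ 0ℤ
      quadratic≈0 = ∣⇒≈0 (divides (c * Q^a * L (L S) n) (trans (cong (λ t → t * (M * M) * L (L S) n) (_∣_.equality q∣triangle))
                                                           (quadratic c Q Q^a (L (L S) n))))

    P[qT]≡QMU : P (q ℕ.* T) ≡ Q * M * U mod Q * (Q * M)
    P[qT]≡QMU = begin
      P (q ℕ.* T)                       ≡⟨ cong P (sym (ℕP.+-identityʳ (q ℕ.* T))) ⟩
      P (q ℕ.* T ℕ.+ 0)                 ≈⟨ q-fold-shift P P-pellLike 0 ⟩
      0ℤ + Q * M * (U * 1ℤ + V * 0ℤ)    ≡⟨ at-0 Q M U V ⟩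
      Q * M * U                         ∎
      where
      open Congruence (Q * (Q * M))
      open ≈-Reasoning
      at-0 : ∀ Q M U V → 0ℤ + Q * M * (U * 1ℤ + V * 0ℤ) ≡ Q * M * U
      at-0 = solve-∀

    P′[qT]-1≡QMV : P′ (q ℕ.* T) - 1ℤ ≡ Q * M * V mod Q * (Q * M)
    P′[qT]-1≡QMV = begin
      P (suc (q ℕ.* T)) - + 2 * P (q ℕ.* T) - 1ℤ                  ≡⟨ cong (λ i → P i - + 2 * P (q ℕ.* T) - 1ℤ) (ℕP.+-comm 1 (q ℕ.* T)) ⟩
      P (q ℕ.* T ℕ.+ 1) - + 2 * P (q ℕ.* T) - 1ℤ                  ≈⟨ +-congʳ -1ℤ (+-cong (q-fold-shift P P-pellLike 1) (-‿cong (*-congˡ (+ 2) P[qT]≡QMU))) ⟩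
      1ℤ + Q * M * (U * + 2 + V * 1ℤ) - + 2 * (Q * M * U) - 1ℤ    ≡⟨ at-1 Q M U V ⟩
      Q * M * V                                                   ∎
      where
      open Congruence (Q * (Q * M))
      open ≈-Reasoning
      at-1 : ∀ Q M U V → 1ℤ + Q * M * (U * + 2 + V * 1ℤ) - + 2 * (Q * M * U) - 1ℤ ≡ Q * M * V
      at-1 = solve-∀

    L-P≡G : ∀ n → L P n ≡ G n mod Q
    L-P≡G n = Mod-q.+-cong (Mod-q.*-congʳ (P (suc n)) U≡u₀) (Mod-q.*-congʳ (P n) V≡v₀)

    G-stable : ∀ k n → G (k ℕ.* T ℕ.+ n) ≡ G n mod Q
    G-stable k n = ≡-mod-weaken (Q∣Q^[1+a] a) (iterate₁ G G-pellLike k n)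

    lift-along-period : ∀ k n {r t s} → P n ≡ r + t * M → t + + k * L P n ≡ s mod Q →
                        P (k ℕ.* T ℕ.+ n) ≡ r + s * M mod Q * M
    lift-along-period k n {r} {t} {s} Pn≡r+tM t+kg≡s = begin
      P (k ℕ.* T ℕ.+ n)               ≈⟨ ≡-mod-weaken QM∣MM (iterate₂ P P-pellLike k n) ⟩
      P n + + k * M * g               ≡⟨ cong (_+ + k * M * g) Pn≡r+tM ⟩
      r + t * M + + k * M * g         ≡⟨ regroup r t M (+ k) g ⟩
      r + M * (t + + k * g)           ≈⟨ +-congˡ r (subst (λ m → M * (t + + k * g) ≡ M * s mod m) (ℤP.*-comm M Q)
                                           (≡-mod-scale M t+kg≡s)) ⟩
      r + M * s                       ≡⟨ cong (_+_ r) (ℤP.*-comm M s) ⟩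
      r + s * M                       ∎
      where
      open Congruence (Q * M)
      open ≈-Reasoning
      g = L P n
      square : ∀ Q e → (Q * e) * (Q * e) ≡ e * (Q * (Q * e))
      square = solve-∀
      QM∣MM : Q * M ∣ M * M
      QM∣MM = divides (Q ℤ.^ a) (square Q (Q ℤ.^ a))
      regroup : ∀ r t M k g → r + t * M + k * M * g ≡ r + M * (t + k * g)
      regroup = solve-∀

  period-step : ∀ {a} → PeriodAt a → PeriodAt (suc a)
  period-step π = record
    { T = q ℕ.* T ; U = U′ ; V = V′
    ; P-T = P[qT]≡QMU′
    ; P′-T = a-s≡c⇒a≡s+c P′[qT]-1≡QMV′
    ; U≡u₀ = Mod-q.≈-trans U′≡U U≡u₀
    ; V≡v₀ = Mod-q.≈-trans V′≡V V≡v₀ }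
    where
    open AtPeriod π
    U-lift = ≡-mod-lift {Q} P[qT]≡QMU
    V-lift = ≡-mod-lift {Q} P′[qT]-1≡QMV
    U′ = proj₁ U-lift
    V′ = proj₁ V-lift
    P[qT]≡QMU′ = proj₁ (proj₂ U-lift)
    U′≡U = proj₂ (proj₂ U-lift)
    P′[qT]-1≡QMV′ = proj₁ (proj₂ V-lift)
    V′≡V = proj₂ (proj₂ V-lift)

  period : ∀ a → PeriodAt a
  period zero = period₀
  period (suc a) = period-step (period a)

  Complete : ℕ → Set
  Complete a = ∀ r → r ℕ.< q ^ a → ∃ λ n → (P n ≡ + r mod Q ℤ.^ a) × ¬ (G n ≡ 0ℤ mod Q)

  -- Write r′ = r + s M with M = qᵃ⁺¹ and pick n hitting r modulo M; since L P n ≡ G n is a unit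
  -- modulo q, some k moves P (k T + n) onto r′ modulo q M.
  complete-step : ∀ {a} → PeriodAt a → Complete (suc a) → Complete (suc (suc a))
  complete-step {a} π complete r′ r′<q^[2+a] = k ℕ.* T ℕ.+ n , hit , Gkn≢0
    where
    open AtPeriod π
    open PrimeField q q-prime using (linear-solution)
    N = q ^ suc a
    instance
      N≢0 : ℕ.NonZero N
      N≢0 = ℕP.m^n≢0 q (suc a) {{prime⇒nonZero q-prime}}
    r = r′ % N
    s = r′ / N
    r′≡r+sM : + r′ ≡ + r + + s * M
    r′≡r+sM = trans (cong +_ (ℕD.m≡m%n+[m/n]*n r′ N))
                (trans (ℤP.pos-+ r (s ℕ.* N)) (cong (_+_ (+ r)) (trans (ℤP.pos-* s N) (cong (+ s *_) (pos-^ q (suc a))))))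
    found = complete r (ℕD.m%n<n r′ N)
    n = proj₁ found
    Pn≡r = proj₁ (proj₂ found)
    Gn≢0 = proj₂ (proj₂ found)
    t = proj₁ (≡-mod⇒∃ Pn≡r)
    g≢0 : ¬ L P n ≡ 0ℤ mod Q
    g≢0 g≡0 = Gn≢0 (Mod-q.≈-trans (Mod-q.≈-sym (L-P≡G n)) g≡0)
    solution = linear-solution g≢0 (+ s - t)
    k = proj₁ solution
    t+kg≡s : t + + k * L P n ≡ + s mod Q
    t+kg≡s = Mod-q.≈-trans (Mod-q.+-congˡ t (proj₂ solution)) (Mod-q.≈-reflexive (cancel t (+ s)))
      where
      cancel : ∀ t s → t + (s - t) ≡ s
      cancel = solve-∀
    hit : P (k ℕ.* T ℕ.+ n) ≡ + r′ mod Q * M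
    hit = subst (λ x → P (k ℕ.* T ℕ.+ n) ≡ x mod Q * M) (sym r′≡r+sM)
            (lift-along-period k n {+ r} {t} {+ s} (proj₂ (≡-mod⇒∃ Pn≡r)) t+kg≡s)
    Gkn≢0 : ¬ G (k ℕ.* T ℕ.+ n) ≡ 0ℤ mod Q
    Gkn≢0 G≡0 = Gn≢0 (Mod-q.≈-trans (Mod-q.≈-sym (G-stable k n)) G≡0)

  Base : Set
  Base = Complete 1

  witness : ∀ n {r} → {True (Mod-q._≈?_ (P n) (+ r))} → {False (Mod-q._≈?_ (G n) 0ℤ)} →
            ∃ λ n → (P n ≡ + r mod Q) × ¬ (G n ≡ 0ℤ mod Q)
  witness n {_} {hit} {miss} = n , toWitness hit , toWitnessFalse miss

  complete : Base → ∀ a → Complete (suc a)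
  complete base zero = base
  complete base (suc a) = complete-step (period a) (complete base a)

  residue-complete : Base → ∀ a .{{_ : ℕ.NonZero (q ^ a)}} → ResidueComplete pell (q ^ a)
  residue-complete base zero zero _ = 0 , refl
  residue-complete base zero (suc r) (ℕ.s≤s ())
  residue-complete base (suc a) r r<q^[1+a] with complete base a r r<q^[1+a]
  ... | n , Pn≡r , _ = n , trans (Residues.≈⇒%ℕ≡ (q ^ suc a) (subst (λ m → P n ≡ + r mod m) (sym (pos-^ q (suc a))) Pn≡r))
                                 (ℕD.m<n⇒m%n≡m r<q^[1+a])

-- P 8 = 3 · 136 and P′ 8 = P 7 = 1 + 3 · 56: 8 is the period of P modulo 3.
module Lifting₃ = Lifting 3 (from-yes (prime? 3)) 8 (+ 136) (+ 56) refl refl (divides 1ℤ refl)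

-- P 12 = 5 · 2772 and P′ 12 = P 11 = 1 + 5 · 1148: 12 is the period of P modulo 5.
module Lifting₅ = Lifting 5 (from-yes (prime? 5)) 12 (+ 2772) (+ 1148) refl refl (divides (+ 2) refl)

base₃ : Lifting₃.Base
base₃ 0 _ = Lifting₃.witness 0
base₃ 1 _ = Lifting₃.witness 1
base₃ 2 _ = Lifting₃.witness 3
base₃ (suc (suc (suc _))) (s≤s (s≤s (s≤s ())))

base₅ : Lifting₅.Base
base₅ 0 _ = Lifting₅.witness 0
base₅ 1 _ = Lifting₅.witness 1
base₅ 2 _ = Lifting₅.witness 2
base₅ 3 _ = Lifting₅.witness 8
base₅ 4 _ = Lifting₅.witness 5
base₅ (suc (suc (suc (suc (suc _))))) (s≤s (s≤s (s≤s (s≤s (s≤s ())))))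

pell-complete-3^ : ∀ a .{{_ : NonZero (3 ^ a)}} → ResidueComplete pell (3 ^ a)
pell-complete-3^ = Lifting₃.residue-complete base₃

pell-complete-5^ : ∀ a .{{_ : NonZero (5 ^ a)}} → ResidueComplete pell (5 ^ a)
pell-complete-5^ = Lifting₅.residue-complete base₅

pell-complete-2 : ResidueComplete pell 2
pell-complete-2 zero _ = 0 , refl
pell-complete-2 (suc zero) _ = 1 , refl
pell-complete-2 (suc (suc _)) (s≤s (s≤s ()))

-- The moduli 4, 6, 10 and 15

module PellModulo (d : ℕ) .{{_ : NonZero d}} where

  step : ℕ × ℕ → ℕ × ℕ
  step (a , b) = b , (2 ℕ.* b ℕ.+ a) % d

  -- (pell n % d , pell (suc n) % d) by iteration; evaluating pell itself takes exponential time.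
  residues : ℕ → ℕ × ℕ
  residues zero = 0 % d , 1 % d
  residues (suc n) = step (residues n)

  step-% : ∀ x y → (2 ℕ.* x ℕ.+ y) % d ≡ (2 ℕ.* (x % d) ℕ.+ y % d) % d
  step-% x y = begin
    (2 ℕ.* x ℕ.+ y) % d                               ≡⟨ ℕD.%-distribˡ-+ (2 ℕ.* x) y d ⟩
    ((2 ℕ.* x) % d ℕ.+ y % d) % d                     ≡⟨ cong (λ z → (z ℕ.+ y % d) % d) 2x% ⟩
    ((2 ℕ.* (x % d)) % d ℕ.+ y % d) % d               ≡⟨ cong (λ z → ((2 ℕ.* (x % d)) % d ℕ.+ z) % d) (sym (ℕD.m%n%n≡m%n y d)) ⟩
    ((2 ℕ.* (x % d)) % d ℕ.+ (y % d) % d) % d         ≡⟨ ℕD.%-distribˡ-+ (2 ℕ.* (x % d)) (y % d) d ⟨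
    (2 ℕ.* (x % d) ℕ.+ y % d) % d                     ∎
    where
    open ≡-Reasoning
    2x% : (2 ℕ.* x) % d ≡ (2 ℕ.* (x % d)) % d
    2x% = trans (ℕD.%-distribˡ-* 2 x d)
            (trans (cong (λ z → ((2 % d) ℕ.* z) % d) (sym (ℕD.m%n%n≡m%n x d))) (sym (ℕD.%-distribˡ-* 2 (x % d) d)))

  residues-pell : ∀ n → residues n ≡ (pell n % d , pell (suc n) % d)
  residues-pell zero = refl
  residues-pell (suc n) = trans (cong step (residues-pell n)) (cong (pell (suc n) % d ,_) (sym (step-% (pell (suc n)) (pell n))))

  module Periodic (T : ℕ) .{{_ : NonZero T}} (period : residues T ≡ residues 0) where

    shift : ∀ n → residues (n ℕ.+ T) ≡ residues n
    shift zero = period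
    shift (suc n) = cong step (shift n)

    shift* : ∀ m k → residues (m ℕ.+ k ℕ.* T) ≡ residues m
    shift* m zero = cong residues (ℕP.+-identityʳ m)
    shift* m (suc k) = trans (cong residues (regroup m k)) (trans (shift (m ℕ.+ k ℕ.* T)) (shift* m k))
      where
      regroup : ∀ m k → m ℕ.+ (T ℕ.+ k ℕ.* T) ≡ m ℕ.+ k ℕ.* T ℕ.+ T
      regroup m k = trans (cong (m ℕ.+_) (ℕP.+-comm T (k ℕ.* T))) (sym (ℕP.+-assoc m (k ℕ.* T) T))

    missing : ∀ r → (∀ {k} → k ℕ.< T → proj₁ (residues k) ≢ r) → ∀ n → pell n % d ≢ r
    missing r absent n Pn≡r = absent (ℕD.m%n<n n T) (trans (cong proj₁ (trans periodic (residues-pell n))) Pn≡r)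
      where
      periodic : residues (n % T) ≡ residues n
      periodic = trans (sym (shift* (n % T) (n / T))) (cong residues (sym (ℕD.m≡m%n+[m/n]*n n T)))

  -- For concrete d, T and r both hypotheses are closed computations, discharged by evaluation.
  avoids : ∀ T .{{_ : NonZero T}} r → residues T ≡ residues 0 →
           {True (ℕP.allUpTo? (λ k → ¬? (proj₁ (residues k) ℕP.≟ r)) T)} → ∀ n → pell n % d ≢ r
  avoids T r period {absent} = Periodic.missing T period r (toWitness absent)

pell-mod-4-≢3 : ∀ n → pell n % 4 ≢ 3
pell-mod-4-≢3 = PellModulo.avoids 4 4 3 refl

pell-mod-6-≢3 : ∀ n → pell n % 6 ≢ 3
pell-mod-6-≢3 = PellModulo.avoids 6 8 3 refl

pell-mod-10-≢3 : ∀ n → pell n % 10 ≢ 3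
pell-mod-10-≢3 = PellModulo.avoids 10 12 3 refl

pell-mod-15-≢6 : ∀ n → pell n % 15 ≢ 6
pell-mod-15-≢6 = PellModulo.avoids 15 24 6 refl

-- Classification of the moduli

divisor-incomplete : ∀ {m d} .{{_ : NonZero m}} .{{_ : NonZero d}} → d ℕ∣.∣ m → ∀ r → r ℕ.< d →
                     (∀ n → pell n % d ≢ r) → ¬ ResidueComplete pell m
divisor-incomplete {m} {d} d∣m r r<d avoids complete with complete r (ℕP.<-≤-trans r<d (ℕ∣.∣⇒≤ d∣m))
... | n , Pn≡r = avoids n (begin
  pell n % d          ≡⟨ ℕD.m∣n⇒o%n%m≡o%m d m (pell n) d∣m ⟨
  pell n % m % d      ≡⟨ cong (_% d) Pn≡r ⟩
  r % d               ≡⟨ ℕD.m<n⇒m%n≡m r<d ⟩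
  r                   ∎)
  where open ≡-Reasoning

Admissible : ℕ → Set
Admissible m = m ≡ 2 ⊎ (∃ λ a → m ≡ 3 ^ a) ⊎ (∃ λ b → m ≡ 5 ^ b)

data Obstruction (m : ℕ) : Set where
  4∣ : 4 ℕ∣.∣ m → Obstruction m
  6∣ : 6 ℕ∣.∣ m → Obstruction m
  10∣ : 10 ℕ∣.∣ m → Obstruction m
  15∣ : 15 ℕ∣.∣ m → Obstruction m
  large-prime∣ : ∀ {p} → Prime p → 7 ℕ.≤ p → p ℕ∣.∣ m → Obstruction m

Obstruction-* : ∀ k {m} → Obstruction m → Obstruction (k ℕ.* m)
Obstruction-* k (4∣ d) = 4∣ (ℕ∣.∣n⇒∣m*n k d)
Obstruction-* k (6∣ d) = 6∣ (ℕ∣.∣n⇒∣m*n k d)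
Obstruction-* k (10∣ d) = 10∣ (ℕ∣.∣n⇒∣m*n k d)
Obstruction-* k (15∣ d) = 15∣ (ℕ∣.∣n⇒∣m*n k d)
Obstruction-* k (large-prime∣ p-prime 7≤p d) = large-prime∣ p-prime 7≤p (ℕ∣.∣n⇒∣m*n k d)

obstruction⇒incomplete : ∀ {m} .{{_ : NonZero m}} → Obstruction m → ¬ ResidueComplete pell m
obstruction⇒incomplete (4∣ d) = divisor-incomplete d 3 (ℕP.<ᵇ⇒< 3 4 _) pell-mod-4-≢3
obstruction⇒incomplete (6∣ d) = divisor-incomplete d 3 (ℕP.<ᵇ⇒< 3 6 _) pell-mod-6-≢3
obstruction⇒incomplete (10∣ d) = divisor-incomplete d 3 (ℕP.<ᵇ⇒< 3 10 _) pell-mod-10-≢3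
obstruction⇒incomplete (15∣ d) = divisor-incomplete d 6 (ℕP.<ᵇ⇒< 6 15 _) pell-mod-15-≢6
obstruction⇒incomplete (large-prime∣ {p} p-prime 7≤p d) =
  divisor-incomplete {{_}} {{p≢0}} d (proj₁ missed) (proj₁ (proj₂ missed)) (proj₂ (proj₂ missed))
  where
  p≢0 = prime⇒nonZero p-prime
  missed : ∃ λ r → r ℕ.< p × ∀ n → _%_ (pell n) p {{p≢0}} ≢ r
  missed = PellModuloLargePrime.pell-misses-residue p p-prime 7≤p

prime-cases : ∀ {p} → Prime p → p ≡ 2 ⊎ p ≡ 3 ⊎ p ≡ 5 ⊎ 7 ℕ.≤ p
prime-cases {p} p-prime with ℕ.nonTrivial⇒n>1 p {{prime⇒nonTrivial p-prime}}
prime-cases {2} _ | _ = inj₁ refl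
prime-cases {3} _ | _ = inj₂ (inj₁ refl)
prime-cases {4} p-prime | _ = ⊥-elim (prime⇒¬composite p-prime composite[4])
prime-cases {5} _ | _ = inj₂ (inj₂ (inj₁ refl))
prime-cases {6} p-prime | _ = ⊥-elim (prime⇒¬composite p-prime composite[6])
prime-cases {suc (suc (suc (suc (suc (suc (suc k))))))} _ | _ = inj₂ (inj₂ (inj₂ (ℕP.≤ᵇ⇒≤ 7 (7 ℕ.+ k) _)))

ab∣a[by] : ∀ a b y → a ℕ.* b ℕ∣.∣ a ℕ.* (b ℕ.* y)
ab∣a[by] a b y = ℕ∣.divides y (trans (sym (ℕP.*-assoc a b y)) (ℕP.*-comm (a ℕ.* b) y))

Admissible-2* : ∀ {m} → Admissible m → Admissible (2 ℕ.* m) ⊎ Obstruction (2 ℕ.* m)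
Admissible-2* (inj₁ refl) = inj₂ (4∣ (ab∣a[by] 2 2 1))
Admissible-2* (inj₂ (inj₁ (zero , refl))) = inj₁ (inj₁ refl)
Admissible-2* (inj₂ (inj₁ (suc a , refl))) = inj₂ (6∣ (ab∣a[by] 2 3 (3 ^ a)))
Admissible-2* (inj₂ (inj₂ (zero , refl))) = inj₁ (inj₁ refl)
Admissible-2* (inj₂ (inj₂ (suc b , refl))) = inj₂ (10∣ (ab∣a[by] 2 5 (5 ^ b)))

Admissible-3* : ∀ {m} → Admissible m → Admissible (3 ℕ.* m) ⊎ Obstruction (3 ℕ.* m)
Admissible-3* (inj₁ refl) = inj₂ (6∣ (ab∣a[by] 3 2 1))
Admissible-3* (inj₂ (inj₁ (a , refl))) = inj₁ (inj₂ (inj₁ (suc a , refl)))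
Admissible-3* (inj₂ (inj₂ (zero , refl))) = inj₁ (inj₂ (inj₁ (1 , refl)))
Admissible-3* (inj₂ (inj₂ (suc b , refl))) = inj₂ (15∣ (ab∣a[by] 3 5 (5 ^ b)))

Admissible-5* : ∀ {m} → Admissible m → Admissible (5 ℕ.* m) ⊎ Obstruction (5 ℕ.* m)
Admissible-5* (inj₁ refl) = inj₂ (10∣ (ab∣a[by] 5 2 1))
Admissible-5* (inj₂ (inj₁ (zero , refl))) = inj₁ (inj₂ (inj₂ (1 , refl)))
Admissible-5* (inj₂ (inj₁ (suc a , refl))) = inj₂ (15∣ (ab∣a[by] 5 3 (3 ^ a)))
Admissible-5* (inj₂ (inj₂ (b , refl))) = inj₁ (inj₂ (inj₂ (suc b , refl)))

admissible-or-obstructed-product : ∀ ps → All Prime ps → Admissible (product ps) ⊎ Obstruction (product ps)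
admissible-or-obstructed-product [] [] = inj₁ (inj₂ (inj₁ (0 , refl)))
admissible-or-obstructed-product (p ∷ ps) (p-prime ∷ ps-prime) with admissible-or-obstructed-product ps ps-prime
... | inj₂ obs = inj₂ (Obstruction-* p obs)
... | inj₁ adm with prime-cases p-prime
...   | inj₁ refl = Admissible-2* adm
...   | inj₂ (inj₁ refl) = Admissible-3* adm
...   | inj₂ (inj₂ (inj₁ refl)) = Admissible-5* adm
...   | inj₂ (inj₂ (inj₂ 7≤p)) = inj₂ (large-prime∣ p-prime 7≤p (ℕ∣.m∣m*n (product ps)))

admissible-or-obstructed : ∀ m .{{_ : NonZero m}} → Admissible m ⊎ Obstruction m
admissible-or-obstructed m = subst (λ n → Admissible n ⊎ Obstruction n) (sym isFactorisation) (admissible-or-obstructed-product factors factorsPrime)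
  where open PrimeFactorisation (factorise m)

proposition5p1 : (m : ℕ) .{{_ : NonZero m}} →
    ResidueComplete pell m ⇔ (m ≡ 2 ⊎ (∃ λ a → m ≡ 3 ^ a) ⊎ (∃ λ b → m ≡ 5 ^ b))
proposition5p1 m = mk⇔ necessary sufficient
  where
  necessary : ResidueComplete pell m → Admissible m
  necessary complete with admissible-or-obstructed m
  ... | inj₁ adm = adm
  ... | inj₂ obs = ⊥-elim (obstruction⇒incomplete obs complete)
  sufficient : Admissible m → ResidueComplete pell m
  sufficient (inj₁ refl) = pell-complete-2
  sufficient (inj₂ (inj₁ (a , refl))) = pell-complete-3^ a
  sufficient (inj₂ (inj₂ (b , refl))) = pell-complete-5^ b
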